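{- Subject reduction and subject expansion for $\vdash_2$. Let $M,N\in\mathcal M$, let $\Gamma$ be a type environment and $U\in\mathbb U$. (1) If $M:\langle\Gamma\vdash_2 U\rangle$ and $M\rhd_\beta^* N$, then $N:\langle\Gamma\vdash_2 U\rangle$. (2) If $N:\langle\Gamma\vdash_2 U\rangle$ and $M\rhd_\beta^* N$, then $M:\langle\Gamma\vdash_2 U\rangle$.
   Context: Terms ($\lambda I^{\mathbb N}$-calculus). Fix a denumerably infinite set $\mathcal V$ of variable names. Indexed variables are $x^n$ with $x\in\mathcal V$, $n\in\mathbb N$. The set $\mathcal M$ of terms, free variables $FV$ and degree $d$ are defined simultaneously: $x^n\in\mathcal M$, $FV(x^n)=\{x^n\}$, $d(x^n)=n$; if $M,N\in\mathcal M$ are joinable ($M\diamond N$, meaning: for all $x\in\mathcal V$, if $x^m\in FV(M)$ and $x^n\in FV(N)$ then $m=n$) then $MN\in\mathcal M$, $FV(MN)=FV(M)\cup FV(N)$, $d(MN)=\min(d(M),d(N))$; if $M\in\mathcal M$ and $x^n\in FV(M)$ then $\lambda x^n.M\in\mathcal M$, $FV(\lambda x^n.M)=FV(M)\setminus\{x^n\}$, $d(\lambda x^n.M)=d(M)$. Terms are taken modulo $\alpha$-conversion; a simultaneous substitution $M[(x_i^{n_i}:=N_i)_{1\le i\le m}]$ is defined only when $M,N_1,\dots,N_m$ are pairwise joinable. $\rhd_\beta$ is the least relation containing $(\lambda x^n.M)N\rhd_\beta M[x^n:=N]$ whenever $d(N)=n$, and compatible: if $M\rhd_\beta N$ and $x^n\in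 FV(M)\cap FV(N)$ then $\lambda x^n.M\rhd_\beta\lambda x^n.N$; if $M\rhd_\beta N$, $M\diamond P$, $N\diamond P$ then $MP\rhd_\beta NP$ and $PM\rhd_\beta PN$. $\rhd_\beta^*$ is its reflexive-transitive closure. $M^+$ is obtained from $M$ by replacing every index $n$ of every variable (free or bound) by $n+1$. Types. Fix denumerably infinite sets $\mathcal A$ (atomic types) and $\mathcal E$ (expansion variables). The sets $\mathbb U$ and $\mathbb T$ are defined simultaneously by $\mathbb U::=\mathbb U\sqcap\mathbb U\mid e\,\mathbb U\ (e\in\mathcal E)\mid\mathbb T$ and $\mathbb T::=a\ (a\in\mathcal A)\mid\mathbb U\to\mathbb T$. Types are quotiented by commutativity, associativity and idempotence of $\sqcap$ and by $e(U_1\sqcap U_2)=eU_1\sqcap eU_2$. Degree: $d(a)=0$, $d(U\to T)=\min(d(U),d(T))$, $d(eU)=d(U)+1$, $d(U\sqcap V)=\min(d(U),d(V))$. Good types: atoms are good; $eU$ is good if $U$ is; $U\to T$ is good if $U,T$ are good and $d(U)\ge d(T)$; $U\sqcap V$ is good if $U,V$ are good and $d(U)=d(V)$. Environments. A type environment is a finite set $\Gamma=\{x_1^{n_1}:U_1,\dots,x_k^{n_k}:U_k\}$ with the $x_i^{n_i}$ pairwise distinct; $dom(\Gamma)=\{x_i^{n_i}\}$; $\Gamma,x^m:U$ denotes adding a declaration for $x^m\notin dom(\Gamma)$. $\Gamma_1\sqcap\Gamma_2$ assigns $U\sqcap U'$ to variables declared $U$ in $\Gamma_1$ and $U'$ in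 $\Gamma_2$, and keeps the other declarations of each. $e\Gamma=(x_i^{n_i+1}:eU_i)_i$ for $\Gamma=(x_i^{n_i}:U_i)_i$. $\Gamma_1\diamond\Gamma_2$ iff for all $x$, $x^m\in dom(\Gamma_1)$ and $x^n\in dom(\Gamma_2)$ imply $m=n$. Typing system $\vdash_2$ (judgements written $M:\langle\Gamma\vdash_2 U\rangle$; $U$ ranges over $\mathbb U$, $T$ over $\mathbb T$): (ax) $x^0:\langle(x^0:T)\vdash_2 T\rangle$ if $T$ is good; ($\to_I$) from $M:\langle\Gamma,x^n:U\vdash_2 T\rangle$ infer $\lambda x^n.M:\langle\Gamma\vdash_2 U\to T\rangle$; ($\to_E$) from $M_1:\langle\Gamma_1\vdash_2 U\to T\rangle$, $M_2:\langle\Gamma_2\vdash_2 U\rangle$ and $\Gamma_1\diamond\Gamma_2$ infer $M_1M_2:\langle\Gamma_1\sqcap\Gamma_2\vdash_2 T\rangle$; ($\sqcap$) from $M:\langle\Gamma_1\vdash_2 U_1\rangle$ and $M:\langle\Gamma_2\vdash_2 U_2\rangle$ infer $M:\langle\Gamma_1\sqcap\Gamma_2\vdash_2 U_1\sqcap U_2\rangle$; (exp) from $M:\langle\Gamma\vdash_2 U\rangle$ infer $M^+:\langle e\Gamma\vdash_2 eU\rangle$; ($\sqsubseteq$) from $M:\langle\Gamma\vdash_2 U\rangle$ and $\langle\Gamma\vdash_2 U\rangle\sqsubseteq\langle\Gamma'\vdash_2 U'\rangle$ infer $M:\langle\Gamma'\vdash_2 U'\rangle$. The relation $\sqsubseteq$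 (on types of $\mathbb U$, on environments, and on typings) is the least relation closed under: reflexivity; transitivity; $U_1\sqcap U_2\sqsubseteq U_1$ if $U_2$ is good and $d(U_1)=d(U_2)$; $U_1\sqcap U_2\sqsubseteq V_1\sqcap V_2$ if $U_1\sqsubseteq V_1$, $U_2\sqsubseteq V_2$; $U_1\to T_1\sqsubseteq U_2\to T_2$ if $U_2\sqsubseteq U_1$, $T_1\sqsubseteq T_2$; $eU_1\sqsubseteq eU_2$ if $U_1\sqsubseteq U_2$; $\Gamma,(y^n:U_1)\sqsubseteq\Gamma,(y^n:U_2)$ if $U_1\sqsubseteq U_2$; $\langle\Gamma_1\vdash_2U_1\rangle\sqsubseteq\langle\Gamma_2\vdash_2U_2\rangle$ if $U_1\sqsubseteq U_2$ and $\Gamma_2\sqsubseteq\Gamma_1$. -}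

module Defs where

open import Data.Nat using (ℕ; zero; suc; _≤_; _⊓_; _≡ᵇ_)
open import Data.Bool using (Bool; true; false; if_then_else_; _∧_)
open import Data.Maybe using (Maybe; just; nothing)
import Data.Maybe as Maybe
open import Data.Product using (_×_; _,_; Σ; ∃)
open import Data.List using (List)
open import Data.List.Membership.Propositional using (_∈_)
open import Relation.Binary.PropositionalEquality using (_≡_)
open import Relation.Binary.Construct.Closure.ReflexiveTransitive using (Star)

-- Terms of the λI^ℕ-calculus, locally nameless representation. A free indexed variable x^n is  fv x n.
-- A bound variable is a de Bruijn index together with its degree
-- (the index n of the binder λx^n). Terms are therefore taken
-- modulo α-conversion by construction.

data Tm : Set where
  fv  : (x n : ℕ) → Tm
  bv  : (k n : ℕ) → Tm
  lam : (n : ℕ) → Tm → Tm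
  app : Tm → Tm → Tm

data _∈FV_ : ℕ × ℕ → Tm → Set where
  fv-here : ∀ {x n} → (x , n) ∈FV fv x n
  fv-lam  : ∀ {v n M} → v ∈FV M → v ∈FV lam n M
  fv-appˡ : ∀ {v M N} → v ∈FV M → v ∈FV app M N
  fv-appʳ : ∀ {v M N} → v ∈FV N → v ∈FV app M N

Joinable : Tm → Tm → Set
Joinable M N = ∀ x m n → (x , m) ∈FV M → (x , n) ∈FV N → m ≡ n

deg : Tm → ℕ
deg (fv x n)  = n
deg (bv k n)  = n
deg (lam n M) = deg M
deg (app M N) = deg M ⊓ deg N

close′ : ℕ → ℕ → ℕ → Tm → Tm
close′ k x n (fv y m)  = if (y ≡ᵇ x) ∧ (m ≡ᵇ n) then bv k n else fv y m
close′ k x n (bv j m)  = bv j m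
close′ k x n (lam m M) = lam m (close′ (suc k) x n M)
close′ k x n (app M N) = app (close′ k x n M) (close′ k x n N)

close : ℕ → ℕ → Tm → Tm
close = close′ 0

open′ : ℕ → Tm → Tm → Tm
open′ k N (fv y m)  = fv y m
open′ k N (bv j m)  = if j ≡ᵇ k then N else bv j m
open′ k N (lam m M) = lam m (open′ (suc k) N M)
open′ k N (app M P) = app (open′ k N M) (open′ k N P)

-- body of λ instantiated with N :  for λx^n.M,  M[x^n := N]
instantiate : Tm → Tm → Tm
instantiate M N = open′ 0 N M

data Term : Tm → Set where
  term-var : ∀ x n → Term (fv x n)
  term-app : ∀ {M N} → Term M → Term N → Joinable M N → Term (app M N)
  term-lam : ∀ {M x n} → Term M → (x , n) ∈FV M → Term (lam n (close x n M))

_⁺ : Tm → Tm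
fv x n ⁺  = fv x (suc n)
bv k n ⁺  = bv k (suc n)
lam n M ⁺ = lam (suc n) (M ⁺)
app M N ⁺ = app (M ⁺) (N ⁺)

data _▷β_ : Tm → Tm → Set where
  β     : ∀ {n M N} → Term (app (lam n M) N) → deg N ≡ n →
          app (lam n M) N ▷β instantiate M N
  ξ-lam : ∀ {M N x n} → M ▷β N → (x , n) ∈FV M → (x , n) ∈FV N →
          lam n (close x n M) ▷β lam n (close x n N)
  ξ-appˡ : ∀ {M N P} → M ▷β N → Term P → Joinable M P → Joinable N P →
           app M P ▷β app N P
  ξ-appʳ : ∀ {M N P} → M ▷β N → Term P → Joinable M P → Joinable N P →
           app P M ▷β app P N

_▷β*_ : Tm → Tm → Set
_▷β*_ = Star _▷β_

-- Types (raw syntax; the quotient is handled by the equivalence ≈)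
-- atoms 𝒜 = ℕ, expansion variables ℰ = ℕ

infixr 7 _⇒_
infixr 6 _∩_

mutual
  data TT : Set where
    atom : ℕ → TT
    _⇒_  : UU → TT → TT

  data UU : Set where
    _∩_ : UU → UU → UU
    ex  : ℕ → UU → UU
    ⌜_⌝ : TT → UU

mutual
  data _≈T_ : TT → TT → Set where
    ≈T-refl  : ∀ {T} → T ≈T T
    ≈T-sym   : ∀ {T T′} → T ≈T T′ → T′ ≈T T
    ≈T-trans : ∀ {T₁ T₂ T₃} → T₁ ≈T T₂ → T₂ ≈T T₃ → T₁ ≈T T₃
    ≈T-⇒     : ∀ {U U′ T T′} → U ≈U U′ → T ≈T T′ → (U ⇒ T) ≈T (U′ ⇒ T′)

  data _≈U_ : UU → UU → Set where
    ≈U-refl  : ∀ {U} → U ≈U U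
    ≈U-sym   : ∀ {U U′} → U ≈U U′ → U′ ≈U U
    ≈U-trans : ∀ {U₁ U₂ U₃} → U₁ ≈U U₂ → U₂ ≈U U₃ → U₁ ≈U U₃
    ≈U-∩     : ∀ {U₁ U₁′ U₂ U₂′} → U₁ ≈U U₁′ → U₂ ≈U U₂′ → (U₁ ∩ U₂) ≈U (U₁′ ∩ U₂′)
    ≈U-ex    : ∀ {e U U′} → U ≈U U′ → ex e U ≈U ex e U′
    ≈U-⌜⌝    : ∀ {T T′} → T ≈T T′ → ⌜ T ⌝ ≈U ⌜ T′ ⌝
    ∩-comm   : ∀ {U V} → (U ∩ V) ≈U (V ∩ U)
    ∩-assoc  : ∀ {U V W} → ((U ∩ V) ∩ W) ≈U (U ∩ (V ∩ W))
    ∩-idem   : ∀ {U} → (U ∩ U) ≈U U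
    ex-dist  : ∀ {e U V} → ex e (U ∩ V) ≈U (ex e U ∩ ex e V)

mutual
  degT : TT → ℕ
  degT (atom a) = 0
  degT (U ⇒ T)  = degU U ⊓ degT T

  degU : UU → ℕ
  degU (U ∩ V)  = degU U ⊓ degU V
  degU (ex e U) = suc (degU U)
  degU ⌜ T ⌝    = degT T

mutual
  data GoodT : TT → Set where
    good-atom : ∀ a → GoodT (atom a)
    good-⇒    : ∀ {U T} → GoodU U → GoodT T → degT T ≤ degU U → GoodT (U ⇒ T)

  data GoodU : UU → Set where
    good-∩   : ∀ {U V} → GoodU U → GoodU V → degU U ≡ degU V → GoodU (U ∩ V)
    good-ex  : ∀ {e U} → GoodU U → GoodU (ex e U)
    good-⌜⌝  : ∀ {T} → GoodT T → GoodU ⌜ T ⌝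

data _⊑_ : UU → UU → Set where
  ⊑-refl  : ∀ {U V} → U ≈U V → U ⊑ V
  ⊑-trans : ∀ {U₁ U₂ U₃} → U₁ ⊑ U₂ → U₂ ⊑ U₃ → U₁ ⊑ U₃
  ⊑-∩ˡ    : ∀ {U₁ U₂} → GoodU U₂ → degU U₁ ≡ degU U₂ → (U₁ ∩ U₂) ⊑ U₁
  ⊑-∩     : ∀ {U₁ U₂ V₁ V₂} → U₁ ⊑ V₁ → U₂ ⊑ V₂ → (U₁ ∩ U₂) ⊑ (V₁ ∩ V₂)
  ⊑-⇒     : ∀ {U₁ U₂ T₁ T₂} → U₂ ⊑ U₁ → ⌜ T₁ ⌝ ⊑ ⌜ T₂ ⌝ → ⌜ U₁ ⇒ T₁ ⌝ ⊑ ⌜ U₂ ⇒ T₂ ⌝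
  ⊑-ex    : ∀ {e U₁ U₂} → U₁ ⊑ U₂ → ex e U₁ ⊑ ex e U₂

Env : Set
Env = ℕ → ℕ → Maybe UU

FinEnv : Env → Set
FinEnv Γ = Σ (List (ℕ × ℕ)) λ L → ∀ x n U → Γ x n ≡ just U → (x , n) ∈ L

∅ : Env
∅ y m = nothing

-- Γ , x^n : U   (used when Γ x n ≡ nothing)
_,[_,_]∶_ : Env → ℕ → ℕ → UU → Env
(Γ ,[ x , n ]∶ U) y m = if (y ≡ᵇ x) ∧ (m ≡ᵇ n) then just U else Γ y m

meetM : Maybe UU → Maybe UU → Maybe UU
meetM (just U) (just V) = just (U ∩ V)
meetM (just U) nothing  = just U
meetM nothing  W        = W

_⊓ₑ_ : Env → Env → Env
(Γ₁ ⊓ₑ Γ₂) y m = meetM (Γ₁ y m) (Γ₂ y m)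

exₑ : ℕ → Env → Env
exₑ e Γ y zero    = nothing
exₑ e Γ y (suc m) = Maybe.map (ex e) (Γ y m)

_⋄ₑ_ : Env → Env → Set
Γ₁ ⋄ₑ Γ₂ = ∀ x m n U V → Γ₁ x m ≡ just U → Γ₂ x n ≡ just V → m ≡ n

data ⊑M : Maybe UU → Maybe UU → Set where
  nothing : ⊑M nothing nothing
  just    : ∀ {U V} → U ⊑ V → ⊑M (just U) (just V)

_⊑ₑ_ : Env → Env → Set
Γ ⊑ₑ Γ′ = ∀ y m → ⊑M (Γ y m) (Γ′ y m)

_⊑ₜ_ : Env × UU → Env × UU → Set
(Γ₁ , U₁) ⊑ₜ (Γ₂ , U₂) = (U₁ ⊑ U₂) × (Γ₂ ⊑ₑ Γ₁)

data _∶⟨_⊢₂_⟩ : Tm → Env → UU → Set where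
  ax   : ∀ {x T} → GoodT T → fv x 0 ∶⟨ ∅ ,[ x , 0 ]∶ ⌜ T ⌝ ⊢₂ ⌜ T ⌝ ⟩
  →I   : ∀ {M Γ x n U T} → M ∶⟨ Γ ,[ x , n ]∶ U ⊢₂ ⌜ T ⌝ ⟩ → Γ x n ≡ nothing →
         (x , n) ∈FV M →                      -- λx^n.M must be a term
         lam n (close x n M) ∶⟨ Γ ⊢₂ ⌜ U ⇒ T ⌝ ⟩
  →E   : ∀ {M₁ M₂ Γ₁ Γ₂ U T} → M₁ ∶⟨ Γ₁ ⊢₂ ⌜ U ⇒ T ⌝ ⟩ → M₂ ∶⟨ Γ₂ ⊢₂ U ⟩ →
         Γ₁ ⋄ₑ Γ₂ →
         Joinable M₁ M₂ →                    -- M₁M₂ must be a term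
         app M₁ M₂ ∶⟨ Γ₁ ⊓ₑ Γ₂ ⊢₂ ⌜ T ⌝ ⟩
  ∩I   : ∀ {M Γ₁ Γ₂ U₁ U₂} → M ∶⟨ Γ₁ ⊢₂ U₁ ⟩ → M ∶⟨ Γ₂ ⊢₂ U₂ ⟩ →
         M ∶⟨ Γ₁ ⊓ₑ Γ₂ ⊢₂ U₁ ∩ U₂ ⟩
  exp  : ∀ {M Γ U e} → M ∶⟨ Γ ⊢₂ U ⟩ → (M ⁺) ∶⟨ exₑ e Γ ⊢₂ ex e U ⟩
  sub  : ∀ {M Γ U Γ′ U′} → M ∶⟨ Γ ⊢₂ U ⟩ → (Γ , U) ⊑ₜ (Γ′ , U′) → M ∶⟨ Γ′ ⊢₂ U′ ⟩

module Submission where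

-- Both directions are proved for a single β-step by induction on typing
-- derivations and then iterated along ▷β*.
-- On the type side, a type is decomposed into its arrow/atom "components" under
-- a prefix of expansion variables; ⊑ only weakens components, which yields
-- generation lemmas (a derivation of U yields derivations of all components of
-- U) and un-expansion (a term of type e W is M⁺ for a term M of type W).
--
-- Subject reduction: the substitution lemma (typing is preserved by replacing
-- x^n by a term typed with the type of x^n) handles the contracted redex.
-- Subject expansion: the anti-substitution lemma splits a typing of P[x^n:=A]
-- into typings of P and of A, from which the redex (λx^n.P)A is retyped.

open import Defs
open import Data.Nat
open import Data.Nat.Properties
open import Data.Bool using (Bool; true; false; if_then_else_; _∧_)
open import Data.Maybe using (Maybe; just; nothing)
import Data.Maybe as Maybe
open import Data.Product using (Σ; ∃; _×_; _,_; proj₁; proj₂)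
open import Data.Sum using (_⊎_; inj₁; inj₂)
open import Data.Empty using (⊥; ⊥-elim)
open import Data.Unit using (⊤; tt)
open import Data.List using (List; []; _∷_; _++_; map; length)
open import Data.List.Properties using (map-++)
open import Data.List.Membership.Propositional using (_∈_)
open import Data.List.Membership.Propositional.Properties using (∈-map⁺; ∈-map⁻; ∈-++⁺ˡ; ∈-++⁺ʳ; ∈-++⁻)
open import Data.List.Relation.Unary.Any using (here; there)
open import Relation.Nullary using (¬_; Dec; yes; no)
open import Relation.Nullary.Decidable using (_×-dec_)
open import Relation.Binary.PropositionalEquality
open import Relation.Binary.Construct.Closure.ReflexiveTransitive using (ε; _◅_)

data ≡ᵇ-View (a b : ℕ) : Bool → Set where
  ≡ᵇ-yes : a ≡ b → ≡ᵇ-View a b true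
  ≡ᵇ-no  : ¬ a ≡ b → ≡ᵇ-View a b false

≡ᵇ-view : ∀ a b → ≡ᵇ-View a b (a ≡ᵇ b)
≡ᵇ-view a b with a ≡ᵇ b | ≡ᵇ⇒≡ a b | ≡⇒≡ᵇ a b
... | true  | sound | _        = ≡ᵇ-yes (sound tt)
... | false | _     | complete = ≡ᵇ-no complete

≡ᵇ-refl : ∀ a → (a ≡ᵇ a) ≡ true
≡ᵇ-refl zero    = refl
≡ᵇ-refl (suc a) = ≡ᵇ-refl a

≡ᵇ-distinct : ∀ {a b} → ¬ a ≡ b → (a ≡ᵇ b) ≡ false
≡ᵇ-distinct {a} {b} ne with a ≡ᵇ b | ≡ᵇ-view a b
... | false | _         = refl
... | true  | ≡ᵇ-yes p = ⊥-elim (ne p)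

sameVar : ℕ → ℕ → ℕ → ℕ → Bool
sameVar y m x n = (y ≡ᵇ x) ∧ (m ≡ᵇ n)

data SameVar (y m x n : ℕ) : Bool → Set where
  same     : y ≡ x → m ≡ n → SameVar y m x n true
  distinct : ¬ (y ≡ x × m ≡ n) → SameVar y m x n false

sameVar-view : ∀ y m x n → SameVar y m x n (sameVar y m x n)
sameVar-view y m x n with y ≡ᵇ x | ≡ᵇ-view y x
... | false | ≡ᵇ-no p = distinct λ q → p (proj₁ q)
... | true  | ≡ᵇ-yes p with m ≡ᵇ n | ≡ᵇ-view m n
...   | true  | ≡ᵇ-yes q = same p q
...   | false | ≡ᵇ-no q  = distinct λ r → q (proj₂ r)

sameVar-refl : ∀ y m → sameVar y m y m ≡ true
sameVar-refl y m rewrite ≡ᵇ-refl y | ≡ᵇ-refl m = refl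

sameVar-distinct : ∀ {y m x n} → ¬ (y ≡ x × m ≡ n) → sameVar y m x n ≡ false
sameVar-distinct {y} {m} {x} {n} ne with sameVar y m x n | sameVar-view y m x n
... | false | _        = refl
... | true  | same p q = ⊥-elim (ne (p , q))

-- Terms are locally closed, which is what makes
-- opening a closed body behave as a named substitution.

LC : ℕ → Tm → Set
LC k (fv x n)  = ⊤
LC k (bv j n)  = j < k
LC k (lam n M) = LC (suc k) M
LC k (app M N) = LC k M × LC k N

LC-weak : ∀ {k k'} M → k ≤ k' → LC k M → LC k' M
LC-weak (fv x n)  le l         = tt
LC-weak (bv j n)  le l         = <-≤-trans l le
LC-weak (lam n M) le l         = LC-weak M (s≤s le) l
LC-weak (app M N) le (l1 , l2) = LC-weak M le l1 , LC-weak N le l2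

LC-close : ∀ k x n M → LC k M → LC (suc k) (close′ k x n M)
LC-close k x n (fv y m) l with sameVar y m x n
... | true  = ≤-refl
... | false = tt
LC-close k x n (bv j m)  l         = m≤n⇒m≤1+n l
LC-close k x n (lam m M) l         = LC-close (suc k) x n M l
LC-close k x n (app M N) (l1 , l2) = LC-close k x n M l1 , LC-close k x n N l2

Term-LC : ∀ {M} → Term M → LC 0 M
Term-LC (term-var x n)               = tt
Term-LC (term-app t1 t2 j)           = Term-LC t1 , Term-LC t2
Term-LC (term-lam {M} {x} {n} t i)   = LC-close 0 x n M (Term-LC t)

appL appR lamB : Tm → Tm
appL (app a b) = a
appL t         = t
appR (app a b) = b
appR t         = t
lamB (lam n a) = a
lamB t         = t

lamN : Tm → ℕ
lamN (lam n a) = n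
lamN t         = 0

substN : ℕ → ℕ → Tm → Tm → Tm
substN x n A (fv y m)  = if sameVar y m x n then A else fv y m
substN x n A (bv j m)  = bv j m
substN x n A (lam m M) = lam m (substN x n A M)
substN x n A (app M N) = app (substN x n A M) (substN x n A N)

-- Opening a closed body is named substitution; in particular the contractum
-- of (λx^n.M)A is M[x^n := A].
open-close : ∀ k x n A M → LC k M → open′ k A (close′ k x n M) ≡ substN x n A M
open-close k x n A (fv y m) l with sameVar y m x n
... | true rewrite ≡ᵇ-refl k = refl
... | false = refl
open-close k x n A (bv j m) l rewrite ≡ᵇ-distinct {j} {k} (<⇒≢ l) = refl
open-close k x n A (lam m M) l         = cong (lam m) (open-close (suc k) x n A M l)
open-close k x n A (app M N) (l1 , l2) = cong₂ app (open-close k x n A M l1) (open-close k x n A N l2)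

inst-close : ∀ x n A M → LC 0 M → instantiate (close x n M) A ≡ substN x n A M
inst-close x n A M l = open-close 0 x n A M l

substN-self : ∀ x n M → substN x n (fv x n) M ≡ M
substN-self x n (fv y m) with sameVar y m x n | sameVar-view y m x n
... | true  | same refl refl = refl
... | false | _              = refl
substN-self x n (bv j m)  = refl
substN-self x n (lam m M) = cong (lam m) (substN-self x n M)
substN-self x n (app M N) = cong₂ app (substN-self x n M) (substN-self x n N)

-- Closing is injective on locally closed terms: reopen with the variable.
close-inj : ∀ k x n M M' → LC k M → LC k M' → close′ k x n M ≡ close′ k x n M' → M ≡ M'
close-inj k x n M M' l l' e = begin
  M                                ≡⟨ sym (substN-self x n M) ⟩
  substN x n (fv x n) M            ≡⟨ sym (open-close k x n (fv x n) M l) ⟩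
  open′ k (fv x n) (close′ k x n M)  ≡⟨ cong (open′ k (fv x n)) e ⟩
  open′ k (fv x n) (close′ k x n M') ≡⟨ open-close k x n (fv x n) M' l' ⟩
  substN x n (fv x n) M'           ≡⟨ substN-self x n M' ⟩
  M'                               ∎
  where open ≡-Reasoning

FV-close⇒ : ∀ k x n M {y m} → (y , m) ∈FV close′ k x n M → (y , m) ∈FV M × ¬ (y ≡ x × m ≡ n)
FV-close⇒ k x n (fv z p) i with sameVar z p x n | sameVar-view z p x n
FV-close⇒ k x n (fv z p) ()      | true  | _
FV-close⇒ k x n (fv z p) fv-here | false | distinct q = fv-here , q
FV-close⇒ k x n (bv j p) ()
FV-close⇒ k x n (lam p M) (fv-lam i)  = let a , b = FV-close⇒ (suc k) x n M i in fv-lam a , b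
FV-close⇒ k x n (app M N) (fv-appˡ i) = let a , b = FV-close⇒ k x n M i in fv-appˡ a , b
FV-close⇒ k x n (app M N) (fv-appʳ i) = let a , b = FV-close⇒ k x n N i in fv-appʳ a , b

FV-close⇐ : ∀ k x n M {y m} → (y , m) ∈FV M → ¬ (y ≡ x × m ≡ n) → (y , m) ∈FV close′ k x n M
FV-close⇐ k x n (fv y m)  fv-here     ne rewrite sameVar-distinct ne = fv-here
FV-close⇐ k x n (lam p M) (fv-lam i)  ne = fv-lam (FV-close⇐ (suc k) x n M i ne)
FV-close⇐ k x n (app M N) (fv-appˡ i) ne = fv-appˡ (FV-close⇐ k x n M i ne)
FV-close⇐ k x n (app M N) (fv-appʳ i) ne = fv-appʳ (FV-close⇐ k x n N i ne)

FV-subst⇒ : ∀ x n A M {y m} → (y , m) ∈FV substN x n A M →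
  ((y , m) ∈FV M × ¬ (y ≡ x × m ≡ n)) ⊎ ((y , m) ∈FV A × (x , n) ∈FV M)
FV-subst⇒ x n A (fv z p) i with sameVar z p x n | sameVar-view z p x n
FV-subst⇒ x n A (fv z p) i       | true  | same refl refl = inj₂ (i , fv-here)
FV-subst⇒ x n A (fv z p) fv-here | false | distinct q     = inj₁ (fv-here , q)
FV-subst⇒ x n A (bv j p) ()
FV-subst⇒ x n A (lam p M) (fv-lam i) with FV-subst⇒ x n A M i
... | inj₁ (a , b) = inj₁ (fv-lam a , b)
... | inj₂ (a , b) = inj₂ (a , fv-lam b)
FV-subst⇒ x n A (app M N) (fv-appˡ i) with FV-subst⇒ x n A M i
... | inj₁ (a , b) = inj₁ (fv-appˡ a , b)
... | inj₂ (a , b) = inj₂ (a , fv-appˡ b)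
FV-subst⇒ x n A (app M N) (fv-appʳ i) with FV-subst⇒ x n A N i
... | inj₁ (a , b) = inj₁ (fv-appʳ a , b)
... | inj₂ (a , b) = inj₂ (a , fv-appʳ b)

FV-subst⇐M : ∀ x n A M {y m} → (y , m) ∈FV M → ¬ (y ≡ x × m ≡ n) → (y , m) ∈FV substN x n A M
FV-subst⇐M x n A (fv y m)  fv-here     ne rewrite sameVar-distinct ne = fv-here
FV-subst⇐M x n A (lam p M) (fv-lam i)  ne = fv-lam (FV-subst⇐M x n A M i ne)
FV-subst⇐M x n A (app M N) (fv-appˡ i) ne = fv-appˡ (FV-subst⇐M x n A M i ne)
FV-subst⇐M x n A (app M N) (fv-appʳ i) ne = fv-appʳ (FV-subst⇐M x n A N i ne)

FV-subst⇐A : ∀ x n A M {y m} → (x , n) ∈FV M → (y , m) ∈FV A → (y , m) ∈FV substN x n A M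
FV-subst⇐A x n A (fv x n)  fv-here     j rewrite sameVar-refl x n = j
FV-subst⇐A x n A (lam p M) (fv-lam i)  j = fv-lam (FV-subst⇐A x n A M i j)
FV-subst⇐A x n A (app M N) (fv-appˡ i) j = fv-appˡ (FV-subst⇐A x n A M i j)
FV-subst⇐A x n A (app M N) (fv-appʳ i) j = fv-appʳ (FV-subst⇐A x n A N i j)

FV-dec : ∀ y n M → Dec ((y , n) ∈FV M)
FV-dec y n (fv z m) with y ≟ z | n ≟ m
... | yes refl | yes refl = yes fv-here
... | no p     | _        = no λ { fv-here → p refl }
... | yes _    | no q     = no λ { fv-here → q refl }
FV-dec y n (bv j m) = no λ ()
FV-dec y n (lam m M) with FV-dec y n M
... | yes p = yes (fv-lam p)
... | no p  = no λ { (fv-lam q) → p q }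
FV-dec y n (app M N) with FV-dec y n M | FV-dec y n N
... | yes p | _     = yes (fv-appˡ p)
... | no p  | yes q = yes (fv-appʳ q)
... | no p  | no q  = no λ { (fv-appˡ r) → p r ; (fv-appʳ r) → q r }

subst-notin : ∀ x n A M → ¬ (x , n) ∈FV M → substN x n A M ≡ M
subst-notin x n A (fv y m) ni with sameVar y m x n | sameVar-view y m x n
... | true  | same refl refl = ⊥-elim (ni fv-here)
... | false | _              = refl
subst-notin x n A (bv j m)  ni = refl
subst-notin x n A (lam m M) ni = cong (lam m) (subst-notin x n A M (λ i → ni (fv-lam i)))
subst-notin x n A (app M N) ni =
  cong₂ app (subst-notin x n A M (λ i → ni (fv-appˡ i))) (subst-notin x n A N (λ i → ni (fv-appʳ i)))

close-notin : ∀ k x n M → ¬ (x , n) ∈FV M → close′ k x n M ≡ M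
close-notin k x n (fv y m) ni with sameVar y m x n | sameVar-view y m x n
... | true  | same refl refl = ⊥-elim (ni fv-here)
... | false | _              = refl
close-notin k x n (bv j m)  ni = refl
close-notin k x n (lam m M) ni = cong (lam m) (close-notin (suc k) x n M (λ i → ni (fv-lam i)))
close-notin k x n (app M N) ni =
  cong₂ app (close-notin k x n M (λ i → ni (fv-appˡ i))) (close-notin k x n N (λ i → ni (fv-appʳ i)))

substN-LC : ∀ k x n A M → LC k M → LC 0 A → LC k (substN x n A M)
substN-LC k x n A (fv y m) l lA with sameVar y m x n
... | true  = LC-weak A z≤n lA
... | false = tt
substN-LC k x n A (bv j m)  l         lA = l
substN-LC k x n A (lam m M) l         lA = substN-LC (suc k) x n A M l lA
substN-LC k x n A (app M N) (l1 , l2) lA = substN-LC k x n A M l1 lA , substN-LC k x n A N l2 lA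

subst-close : ∀ k y n A x n₁ M → ¬ y ≡ x → ¬ (x , n₁) ∈FV A →
  substN y n A (close′ k x n₁ M) ≡ close′ k x n₁ (substN y n A M)
subst-close k y n A x n₁ (fv w m) yx xA with sameVar w m x n₁ | sameVar-view w m x n₁
... | true | same refl refl
  rewrite sameVar-distinct {w} {m} {y} {n} (λ q → yx (sym (proj₁ q))) | sameVar-refl w m = refl
... | false | distinct p with sameVar w m y n
...   | true  = sym (close-notin k x n₁ A xA)
...   | false rewrite sameVar-distinct p = refl
subst-close k y n A x n₁ (bv j m)  yx xA = refl
subst-close k y n A x n₁ (lam m M) yx xA = cong (lam m) (subst-close (suc k) y n A x n₁ M yx xA)
subst-close k y n A x n₁ (app M N) yx xA =
  cong₂ app (subst-close k y n A x n₁ M yx xA) (subst-close k y n A x n₁ N yx xA)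

close⁺ : ∀ k x n M → (close′ k x n M) ⁺ ≡ close′ k x (suc n) (M ⁺)
close⁺ k x n (fv y m) with sameVar y m x n
... | true  = refl
... | false = refl
close⁺ k x n (bv j m)  = refl
close⁺ k x n (lam m M) = cong (lam (suc m)) (close⁺ (suc k) x n M)
close⁺ k x n (app M N) = cong₂ app (close⁺ k x n M) (close⁺ k x n N)

open⁺ : ∀ k A M → (open′ k A M) ⁺ ≡ open′ k (A ⁺) (M ⁺)
open⁺ k A (fv y m) = refl
open⁺ k A (bv j m) with j ≡ᵇ k
... | true  = refl
... | false = refl
open⁺ k A (lam m M) = cong (lam (suc m)) (open⁺ (suc k) A M)
open⁺ k A (app M N) = cong₂ app (open⁺ k A M) (open⁺ k A N)

subst⁺ : ∀ x n A M → (substN x n A M) ⁺ ≡ substN x (suc n) (A ⁺) (M ⁺)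
subst⁺ x n A (fv y m) with sameVar y m x n
... | true  = refl
... | false = refl
subst⁺ x n A (bv j m)  = refl
subst⁺ x n A (lam m M) = cong (lam (suc m)) (subst⁺ x n A M)
subst⁺ x n A (app M N) = cong₂ app (subst⁺ x n A M) (subst⁺ x n A N)

deg⁺ : ∀ M → deg (M ⁺) ≡ suc (deg M)
deg⁺ (fv x n)  = refl
deg⁺ (bv k n)  = refl
deg⁺ (lam n M) = deg⁺ M
deg⁺ (app M N) rewrite deg⁺ M | deg⁺ N = refl

_⁻ : Tm → Tm
fv x n ⁻  = fv x (pred n)
bv k n ⁻  = bv k (pred n)
lam n M ⁻ = lam (pred n) (M ⁻)
app M N ⁻ = app (M ⁻) (N ⁻)

⁺⁻ : ∀ M → (M ⁺) ⁻ ≡ M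
⁺⁻ (fv x n)  = refl
⁺⁻ (bv k n)  = refl
⁺⁻ (lam n M) = cong (lam n) (⁺⁻ M)
⁺⁻ (app M N) = cong₂ app (⁺⁻ M) (⁺⁻ N)

⁺-inj : ∀ M N → M ⁺ ≡ N ⁺ → M ≡ N
⁺-inj M N e = trans (sym (⁺⁻ M)) (trans (cong _⁻ e) (⁺⁻ N))

FV-⁺⇒ : ∀ M {y m} → (y , m) ∈FV M → (y , suc m) ∈FV (M ⁺)
FV-⁺⇒ (fv y m)  fv-here     = fv-here
FV-⁺⇒ (lam p M) (fv-lam i)  = fv-lam (FV-⁺⇒ M i)
FV-⁺⇒ (app M N) (fv-appˡ i) = fv-appˡ (FV-⁺⇒ M i)
FV-⁺⇒ (app M N) (fv-appʳ i) = fv-appʳ (FV-⁺⇒ N i)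

FV-⁺⇐ : ∀ M {y m} → (y , m) ∈FV (M ⁺) → Σ ℕ λ m₀ → m ≡ suc m₀ × (y , m₀) ∈FV M
FV-⁺⇐ (fv y m) fv-here = m , refl , fv-here
FV-⁺⇐ (bv j m) ()
FV-⁺⇐ (lam p M) (fv-lam i)  = let a , b , c = FV-⁺⇐ M i in a , b , fv-lam c
FV-⁺⇐ (app M N) (fv-appˡ i) = let a , b , c = FV-⁺⇐ M i in a , b , fv-appˡ c
FV-⁺⇐ (app M N) (fv-appʳ i) = let a , b , c = FV-⁺⇐ N i in a , b , fv-appʳ c

FV-⁺⇐' : ∀ M {y m} → (y , suc m) ∈FV (M ⁺) → (y , m) ∈FV M
FV-⁺⇐' M i with FV-⁺⇐ M i
... | a , refl , c = c

Joinable-⁺ : ∀ M N → Joinable M N → Joinable (M ⁺) (N ⁺)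
Joinable-⁺ M N j x m n i i' with FV-⁺⇐ M i | FV-⁺⇐ N i'
... | a , refl , c | b , refl , d = cong suc (j x a b c d)

Joinable-⁺⁻¹ : ∀ M N → Joinable (M ⁺) (N ⁺) → Joinable M N
Joinable-⁺⁻¹ M N j x m n i i' = suc-injective (j x (suc m) (suc n) (FV-⁺⇒ M i) (FV-⁺⇒ N i'))

Term⁺ : ∀ {M} → Term M → Term (M ⁺)
Term⁺ (term-var x n)               = term-var x (suc n)
Term⁺ (term-app {M} {N} t1 t2 j)   = term-app (Term⁺ t1) (Term⁺ t2) (Joinable-⁺ M N j)
Term⁺ (term-lam {M} {x} {n} t i) rewrite close⁺ 0 x n M = term-lam (Term⁺ t) (FV-⁺⇒ M i)

-- Pos M: every index occurring in M (free, bound or binder) is at least 1.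
-- These are exactly the shifted terms.
Pos : Tm → Set
Pos (fv x n)  = 1 ≤ n
Pos (bv j n)  = 1 ≤ n
Pos (lam n M) = 1 ≤ n × Pos M
Pos (app M N) = Pos M × Pos N

Pos-⁺ : ∀ M → Pos (M ⁺)
Pos-⁺ (fv x n)  = s≤s z≤n
Pos-⁺ (bv j n)  = s≤s z≤n
Pos-⁺ (lam n M) = s≤s z≤n , Pos-⁺ M
Pos-⁺ (app M N) = Pos-⁺ M , Pos-⁺ N

⁻⁺ : ∀ M → Pos M → (M ⁻) ⁺ ≡ M
⁻⁺ (fv x (suc n))  p       = refl
⁻⁺ (bv j (suc n))  p       = refl
⁻⁺ (lam (suc n) M) (p , q) = cong (lam (suc n)) (⁻⁺ M q)
⁻⁺ (app M N)       (p , q) = cong₂ app (⁻⁺ M p) (⁻⁺ N q)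

unshift : ∀ M → Pos M → Σ Tm λ M₀ → M ≡ M₀ ⁺
unshift M p = M ⁻ , sym (⁻⁺ M p)

Pos-close⇐ : ∀ k x n P → 1 ≤ n → Pos (close′ k x n P) → Pos P
Pos-close⇐ k x n (fv y m) h p with sameVar y m x n | sameVar-view y m x n
... | true  | same refl refl = h
... | false | _              = p
Pos-close⇐ k x n (bv j m)  h p       = p
Pos-close⇐ k x n (lam m P) h (a , b) = a , Pos-close⇐ (suc k) x n P h b
Pos-close⇐ k x n (app M N) h (a , b) = Pos-close⇐ k x n M h a , Pos-close⇐ k x n N h b

Pos-close⇒ : ∀ k x n P → 1 ≤ n → Pos P → Pos (close′ k x n P)
Pos-close⇒ k x n (fv y m) h p with sameVar y m x n
... | true  = h
... | false = p
Pos-close⇒ k x n (bv j m)  h p       = p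
Pos-close⇒ k x n (lam m P) h (a , b) = a , Pos-close⇒ (suc k) x n P h b
Pos-close⇒ k x n (app M N) h (a , b) = Pos-close⇒ k x n M h a , Pos-close⇒ k x n N h b

Pos-subst⇒P : ∀ x n A P → 1 ≤ n → Pos (substN x n A P) → Pos P
Pos-subst⇒P x n A (fv y m) h p with sameVar y m x n | sameVar-view y m x n
... | true  | same refl refl = h
... | false | _              = p
Pos-subst⇒P x n A (bv j m)  h p       = p
Pos-subst⇒P x n A (lam m P) h (a , b) = a , Pos-subst⇒P x n A P h b
Pos-subst⇒P x n A (app M N) h (a , b) = Pos-subst⇒P x n A M h a , Pos-subst⇒P x n A N h b

Pos-subst⇒A : ∀ x n A P → (x , n) ∈FV P → Pos (substN x n A P) → Pos A
Pos-subst⇒A x n A (fv x n)  fv-here     p rewrite sameVar-refl x n = p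
Pos-subst⇒A x n A (lam m P) (fv-lam i)  (a , b) = Pos-subst⇒A x n A P i b
Pos-subst⇒A x n A (app M N) (fv-appˡ i) (a , b) = Pos-subst⇒A x n A M i a
Pos-subst⇒A x n A (app M N) (fv-appʳ i) (a , b) = Pos-subst⇒A x n A N i b

Pos-deg : ∀ A → Pos A → 1 ≤ deg A
Pos-deg (fv x n)  p       = p
Pos-deg (bv j n)  p       = p
Pos-deg (lam n A) (a , b) = Pos-deg A b
Pos-deg (app M N) (a , b) = ⊓-glb (Pos-deg M a) (Pos-deg N b)

λ-⁺⁻¹ : ∀ {x n P n₀ C₀} → lam n (close x n P) ≡ (lam n₀ C₀) ⁺ →
  Σ Tm λ P₀ → n ≡ suc n₀ × P ≡ P₀ ⁺ × C₀ ≡ close x n₀ P₀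
λ-⁺⁻¹ {x} {n} {P} {n₀} {C₀} e with cong lamN e | cong lamB e
... | refl | e′ with unshift P (Pos-close⇐ 0 x (suc n₀) P (s≤s z≤n) (subst Pos (sym e′) (Pos-⁺ C₀)))
... | P₀ , refl = P₀ , refl , refl , ⁺-inj C₀ (close x n₀ P₀) (trans (sym e′) (sym (close⁺ 0 x n₀ P₀)))

Term⁻ : ∀ {M} → Term M → ∀ M₀ → M ≡ M₀ ⁺ → Term M₀
Term⁻ (term-var x n) (fv y m) e = term-var y m
Term⁻ (term-app {M} {N} t1 t2 j) (app a b) e with cong appL e | cong appR e
... | refl | refl = term-app (Term⁻ t1 a refl) (Term⁻ t2 b refl) (Joinable-⁺⁻¹ a b j)
Term⁻ (term-lam {P} t i) (lam n₀ C₀) e with λ-⁺⁻¹ {P = P} e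
... | P₀ , refl , refl , refl = term-lam (Term⁻ t P₀ refl) (FV-⁺⇐' P₀ i)
Term⁻ (term-var x n) (bv _ _)  ()
Term⁻ (term-var x n) (lam _ _) ()
Term⁻ (term-var x n) (app _ _) ()
Term⁻ (term-app _ _ _) (fv _ _)  ()
Term⁻ (term-app _ _ _) (bv _ _)  ()
Term⁻ (term-app _ _ _) (lam _ _) ()
Term⁻ (term-lam _ _) (fv _ _)  ()
Term⁻ (term-lam _ _) (bv _ _)  ()
Term⁻ (term-lam _ _) (app _ _) ()
-- Name swapping (x y) acts on the names of free variables, keeping indices.
-- Everything in sight is equivariant under it; combined with fresh names it
-- replaces α-renaming of binders.

swapℕ : ℕ → ℕ → ℕ → ℕ
swapℕ a b c = if c ≡ᵇ a then b else (if c ≡ᵇ b then a else c)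

swap : ℕ → ℕ → Tm → Tm
swap a b (fv y m) = fv (swapℕ a b y) m
swap a b (bv j m) = bv j m
swap a b (lam m M) = lam m (swap a b M)
swap a b (app M N) = app (swap a b M) (swap a b N)

swapℕ-invol : ∀ a b c → swapℕ a b (swapℕ a b c) ≡ c
swapℕ-invol a b c with c ≡ᵇ a | ≡ᵇ-view c a
... | true | ≡ᵇ-yes refl with b ≡ᵇ c | ≡ᵇ-view b c
...   | true | ≡ᵇ-yes refl = refl
...   | false | ≡ᵇ-no q rewrite ≡ᵇ-refl b = refl
swapℕ-invol a b c | false | ≡ᵇ-no p with c ≡ᵇ b | ≡ᵇ-view c b
...   | true | ≡ᵇ-yes refl rewrite ≡ᵇ-refl a = refl
...   | false | ≡ᵇ-no q rewrite ≡ᵇ-distinct p | ≡ᵇ-distinct q = refl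

swapℕ-inj : ∀ a b {c d} → swapℕ a b c ≡ swapℕ a b d → c ≡ d
swapℕ-inj a b {c} {d} e = trans (sym (swapℕ-invol a b c)) (trans (cong (swapℕ a b) e) (swapℕ-invol a b d))

swapℕ-left : ∀ a b → swapℕ a b a ≡ b
swapℕ-left a b rewrite ≡ᵇ-refl a = refl

swapℕ-right : ∀ a b → swapℕ a b b ≡ a
swapℕ-right a b with b ≡ᵇ a | ≡ᵇ-view b a
... | true | ≡ᵇ-yes refl = refl
... | false | ≡ᵇ-no _ rewrite ≡ᵇ-refl b = refl

swapℕ-other : ∀ a b c → ¬ c ≡ a → ¬ c ≡ b → swapℕ a b c ≡ c
swapℕ-other a b c p q rewrite ≡ᵇ-distinct p | ≡ᵇ-distinct q = refl

sameVar-swap : ∀ a b y m x n → sameVar (swapℕ a b y) m (swapℕ a b x) n ≡ sameVar y m x n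
sameVar-swap a b y m x n with sameVar y m x n | sameVar-view y m x n
... | true | same refl refl = sameVar-refl (swapℕ a b y) m
... | false | distinct p = sameVar-distinct λ q → p (swapℕ-inj a b (proj₁ q) , proj₂ q)

swap-invol : ∀ a b M → swap a b (swap a b M) ≡ M
swap-invol a b (fv y m) = cong (λ z → fv z m) (swapℕ-invol a b y)
swap-invol a b (bv j m) = refl
swap-invol a b (lam m M) = cong (lam m) (swap-invol a b M)
swap-invol a b (app M N) = cong₂ app (swap-invol a b M) (swap-invol a b N)

swap-close : ∀ a b k x n M → swap a b (close′ k x n M) ≡ close′ k (swapℕ a b x) n (swap a b M)
swap-close a b k x n (fv y m) rewrite sameVar-swap a b y m x n with sameVar y m x n
... | true = refl
... | false = refl
swap-close a b k x n (bv j m) = refl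
swap-close a b k x n (lam m M) = cong (lam m) (swap-close a b (suc k) x n M)
swap-close a b k x n (app M N) = cong₂ app (swap-close a b k x n M) (swap-close a b k x n N)

swap-open : ∀ a b k A M → swap a b (open′ k A M) ≡ open′ k (swap a b A) (swap a b M)
swap-open a b k A (fv y m) = refl
swap-open a b k A (bv j m) with j ≡ᵇ k
... | true = refl
... | false = refl
swap-open a b k A (lam m M) = cong (lam m) (swap-open a b (suc k) A M)
swap-open a b k A (app M N) = cong₂ app (swap-open a b k A M) (swap-open a b k A N)

swap-subst : ∀ a b x n A M → swap a b (substN x n A M) ≡ substN (swapℕ a b x) n (swap a b A) (swap a b M)
swap-subst a b x n A (fv y m) rewrite sameVar-swap a b y m x n with sameVar y m x n
... | true = refl
... | false = refl
swap-subst a b x n A (bv j m) = refl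
swap-subst a b x n A (lam m M) = cong (lam m) (swap-subst a b x n A M)
swap-subst a b x n A (app M N) = cong₂ app (swap-subst a b x n A M) (swap-subst a b x n A N)

swap-⁺ : ∀ a b M → swap a b (M ⁺) ≡ (swap a b M) ⁺
swap-⁺ a b (fv y m) = refl
swap-⁺ a b (bv j m) = refl
swap-⁺ a b (lam m M) = cong (lam (suc m)) (swap-⁺ a b M)
swap-⁺ a b (app M N) = cong₂ app (swap-⁺ a b M) (swap-⁺ a b N)

swap-deg : ∀ a b M → deg (swap a b M) ≡ deg M
swap-deg a b (fv y m) = refl
swap-deg a b (bv j m) = refl
swap-deg a b (lam m M) = swap-deg a b M
swap-deg a b (app M N) = cong₂ _⊓_ (swap-deg a b M) (swap-deg a b N)

swap-LC : ∀ a b k M → LC k M → LC k (swap a b M)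
swap-LC a b k (fv y m) l = tt
swap-LC a b k (bv j m) l = l
swap-LC a b k (lam m M) l = swap-LC a b (suc k) M l
swap-LC a b k (app M N) (p , q) = swap-LC a b k M p , swap-LC a b k N q

FV-swap : ∀ a b M {y m} → (y , m) ∈FV M → (swapℕ a b y , m) ∈FV swap a b M
FV-swap a b (fv y m) fv-here = fv-here
FV-swap a b (lam p M) (fv-lam i) = fv-lam (FV-swap a b M i)
FV-swap a b (app M N) (fv-appˡ i) = fv-appˡ (FV-swap a b M i)
FV-swap a b (app M N) (fv-appʳ i) = fv-appʳ (FV-swap a b N i)

FV-swap⁻¹ : ∀ a b M {y m} → (y , m) ∈FV swap a b M → (swapℕ a b y , m) ∈FV M
FV-swap⁻¹ a b M {y} {m} i = subst (λ t → (swapℕ a b y , m) ∈FV t) (swap-invol a b M) (FV-swap a b (swap a b M) i)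

Joinable-swap : ∀ a b M N → Joinable M N → Joinable (swap a b M) (swap a b N)
Joinable-swap a b M N j x m n i i' = j (swapℕ a b x) m n (FV-swap⁻¹ a b M i) (FV-swap⁻¹ a b N i')

Term-swap : ∀ a b {M} → Term M → Term (swap a b M)
Term-swap a b (term-var x n) = term-var _ n
Term-swap a b (term-app {M} {N} t1 t2 j) = term-app (Term-swap a b t1) (Term-swap a b t2) (Joinable-swap a b M N j)
Term-swap a b (term-lam {M} {x} {n} t i) rewrite swap-close a b 0 x n M = term-lam (Term-swap a b t) (FV-swap a b M i)

NoName : ℕ → Tm → Set
NoName a M = ∀ m → ¬ (a , m) ∈FV M

swap-fresh : ∀ a b M → NoName a M → NoName b M → swap a b M ≡ M
swap-fresh a b (fv y m) na nb = cong (λ z → fv z m) (swapℕ-other a b y (λ { refl → na m fv-here }) (λ { refl → nb m fv-here }))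
swap-fresh a b (bv j m) na nb = refl
swap-fresh a b (lam m M) na nb = cong (lam m) (swap-fresh a b M (λ k i → na k (fv-lam i)) (λ k i → nb k (fv-lam i)))
swap-fresh a b (app M N) na nb = cong₂ app (swap-fresh a b M (λ k i → na k (fv-appˡ i)) (λ k i → nb k (fv-appˡ i)))
                                       (swap-fresh a b N (λ k i → na k (fv-appʳ i)) (λ k i → nb k (fv-appʳ i)))

NoName-λ : ∀ {a n C} → NoName a (lam n C) → NoName a C
NoName-λ na m k = na m (fv-lam k)

Term-self-joinable : ∀ {M} → Term M → Joinable M M
Term-self-joinable (term-var x n) y a b fv-here fv-here = refl
Term-self-joinable (term-app t1 t2 j) y a b (fv-appˡ i) (fv-appˡ i') = Term-self-joinable t1 y a b i i'
Term-self-joinable (term-app t1 t2 j) y a b (fv-appˡ i) (fv-appʳ i') = j y a b i i'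
Term-self-joinable (term-app t1 t2 j) y a b (fv-appʳ i) (fv-appˡ i') = sym (j y b a i' i)
Term-self-joinable (term-app t1 t2 j) y a b (fv-appʳ i) (fv-appʳ i') = Term-self-joinable t2 y a b i i'
Term-self-joinable (term-lam {M} {x} {n} t i) y a b (fv-lam k) (fv-lam k') =
  Term-self-joinable t y a b (proj₁ (FV-close⇒ 0 x n M k)) (proj₁ (FV-close⇒ 0 x n M k'))

λ-binder-fresh : ∀ {M x n} → Term M → (x , n) ∈FV M → NoName x (lam n (close x n M))
λ-binder-fresh {M} {x} {n} t i m (fv-lam k) =
  let a , b = FV-close⇒ 0 x n M k in b (refl , Term-self-joinable t x m n a i)

-- Fresh names: anything above the largest free name.
maxFV : Tm → ℕ
maxFV (fv x n)  = x
maxFV (bv j n)  = 0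
maxFV (lam n M) = maxFV M
maxFV (app M N) = maxFV M ⊔ maxFV N

maxFV-bound : ∀ M {a k} → (a , k) ∈FV M → a ≤ maxFV M
maxFV-bound (fv x n)  fv-here     = ≤-refl
maxFV-bound (lam n M) (fv-lam i)  = maxFV-bound M i
maxFV-bound (app M N) (fv-appˡ i) = ≤-trans (maxFV-bound M i) (m≤m⊔n (maxFV M) (maxFV N))
maxFV-bound (app M N) (fv-appʳ i) = ≤-trans (maxFV-bound N i) (m≤n⊔m (maxFV M) (maxFV N))

fresh-NoName : ∀ M {z} → maxFV M < z → NoName z M
fresh-NoName M lt m i = <-irrefl refl (≤-<-trans (maxFV-bound M i) lt)

close-α : ∀ x x' n M₀ M' → LC 0 M₀ → LC 0 M' → close x n M₀ ≡ close x' n M' →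
  NoName x (close x n M₀) → NoName x' (close x n M₀) → M' ≡ swap x x' M₀
close-α x x' n M₀ M' l₀ l' eq nx nx' =
  sym (close-inj 0 x' n (swap x x' M₀) M' (swap-LC x x' 0 M₀ l₀) l' (begin
    close x' n (swap x x' M₀)             ≡⟨ cong (λ t → close t n (swap x x' M₀)) (sym (swapℕ-left x x')) ⟩
    close (swapℕ x x' x) n (swap x x' M₀) ≡⟨ sym (swap-close x x' 0 x n M₀) ⟩
    swap x x' (close x n M₀)              ≡⟨ swap-fresh x x' (close x n M₀) nx nx' ⟩
    close x n M₀                          ≡⟨ eq ⟩
    close x' n M'                         ∎))
  where open ≡-Reasoning

close-rebind : ∀ x x' n Q → NoName x (close x' n Q) → NoName x' (close x' n Q) →
  close x n (swap x x' Q) ≡ close x' n Q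
close-rebind x x' n Q nx nx' = begin
  close x n (swap x x' Q)              ≡⟨ cong (λ t → close t n (swap x x' Q)) (sym (swapℕ-right x x')) ⟩
  close (swapℕ x x' x') n (swap x x' Q) ≡⟨ sym (swap-close x x' 0 x' n Q) ⟩
  swap x x' (close x' n Q)             ≡⟨ swap-fresh x x' (close x' n Q) nx nx' ⟩
  close x' n Q                         ∎
  where open ≡-Reasoning

▷β-Term : ∀ {M N} → M ▷β N → Term M
▷β-Term (β t e)            = t
▷β-Term (ξ-lam s i j)      = term-lam (▷β-Term s) i
▷β-Term (ξ-appˡ s t j1 j2) = term-app (▷β-Term s) t j1
▷β-Term (ξ-appʳ s t j1 j2) = term-app t (▷β-Term s) (λ x m n a b → sym (j1 x n m b a))

▷β-swap : ∀ a b {M N} → M ▷β N → swap a b M ▷β swap a b N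
▷β-swap a b (β {n} {M} {N} t e) rewrite swap-open a b 0 N M =
  β (Term-swap a b t) (trans (swap-deg a b N) e)
▷β-swap a b (ξ-lam {M} {N} {x} {n} s i j) rewrite swap-close a b 0 x n M | swap-close a b 0 x n N =
  ξ-lam (▷β-swap a b s) (FV-swap a b M i) (FV-swap a b N j)
▷β-swap a b (ξ-appˡ {M} {N} {P} s t j1 j2) =
  ξ-appˡ (▷β-swap a b s) (Term-swap a b t) (Joinable-swap a b M P j1) (Joinable-swap a b N P j2)
▷β-swap a b (ξ-appʳ {M} {N} {P} s t j1 j2) =
  ξ-appʳ (▷β-swap a b s) (Term-swap a b t) (Joinable-swap a b M P j1) (Joinable-swap a b N P j2)

⁺-reflects-▷β : ∀ {M N} → M ▷β N → ∀ M₀ → M ≡ M₀ ⁺ → Σ Tm λ N₀ → N ≡ N₀ ⁺ × M₀ ▷β N₀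
⁺-reflects-▷β (β t e) (app (lam n₀ B₀) A₀) eq
  with cong (λ z → lamN (appL z)) eq | cong (λ z → lamB (appL z)) eq | cong appR eq
... | refl | refl | refl = instantiate B₀ A₀ , sym (open⁺ 0 A₀ B₀) ,
      β (Term⁻ t (app (lam n₀ B₀) A₀) refl) (suc-injective (trans (sym (deg⁺ A₀)) e))
⁺-reflects-▷β (ξ-lam {M} s i j) (lam n₀ C₀) eq with λ-⁺⁻¹ {P = M} eq
... | P₀ , refl , refl , refl with ⁺-reflects-▷β s P₀ refl
... | Q₀ , refl , s' = lam n₀ (close _ n₀ Q₀) , cong (lam (suc n₀)) (sym (close⁺ 0 _ n₀ Q₀)) ,
      ξ-lam s' (FV-⁺⇐' P₀ i) (FV-⁺⇐' Q₀ j)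
⁺-reflects-▷β (ξ-appˡ s t j1 j2) (app a b) eq with cong appL eq | cong appR eq
... | refl | refl with ⁺-reflects-▷β s a refl
... | N₀ , refl , s' = app N₀ b , refl , ξ-appˡ s' (Term⁻ t b refl) (Joinable-⁺⁻¹ a b j1) (Joinable-⁺⁻¹ N₀ b j2)
⁺-reflects-▷β (ξ-appʳ s t j1 j2) (app a b) eq with cong appL eq | cong appR eq
... | refl | refl with ⁺-reflects-▷β s b refl
... | N₀ , refl , s' = app a N₀ , refl , ξ-appʳ s' (Term⁻ t a refl) (Joinable-⁺⁻¹ b a j1) (Joinable-⁺⁻¹ N₀ a j2)
⁺-reflects-▷β (β t e) (app (fv _ _) _)    ()
⁺-reflects-▷β (β t e) (app (bv _ _) _)    ()
⁺-reflects-▷β (β t e) (app (app _ _) _)   ()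
⁺-reflects-▷β (β t e) (fv _ _)            ()
⁺-reflects-▷β (β t e) (bv _ _)            ()
⁺-reflects-▷β (β t e) (lam _ _)           ()
⁺-reflects-▷β (ξ-lam s i j) (fv _ _)      ()
⁺-reflects-▷β (ξ-lam s i j) (bv _ _)      ()
⁺-reflects-▷β (ξ-lam s i j) (app _ _)     ()
⁺-reflects-▷β (ξ-appˡ s t j1 j2) (fv _ _)  ()
⁺-reflects-▷β (ξ-appˡ s t j1 j2) (bv _ _)  ()
⁺-reflects-▷β (ξ-appˡ s t j1 j2) (lam _ _) ()
⁺-reflects-▷β (ξ-appʳ s t j1 j2) (fv _ _)  ()
⁺-reflects-▷β (ξ-appʳ s t j1 j2) (bv _ _)  ()
⁺-reflects-▷β (ξ-appʳ s t j1 j2) (lam _ _) ()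

-- Redex degrees match, so positivity of the reduct forces it on the redex.
Pos-▷β⁻¹ : ∀ {M N} → M ▷β N → Pos N → Pos M
Pos-▷β⁻¹ (β {n} {_} {A} (term-app (term-lam {B} {x} {n} tB i) tA j) e) p
  rewrite inst-close x n A B (Term-LC tB) =
  let pA = Pos-subst⇒A x n A B i p
      h  = subst (1 ≤_) e (Pos-deg A pA)
  in (h , Pos-close⇒ 0 x n B h (Pos-subst⇒P x n A B h p)) , pA
Pos-▷β⁻¹ (ξ-lam {M} {N} {x} {n} s i j) (h , p) = h , Pos-close⇒ 0 x n M h (Pos-▷β⁻¹ s (Pos-close⇐ 0 x n N h p))
Pos-▷β⁻¹ (ξ-appˡ s t j1 j2) (p , q) = Pos-▷β⁻¹ s p , q
Pos-▷β⁻¹ (ξ-appʳ s t j1 j2) (p , q) = p , Pos-▷β⁻¹ s q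

▷β-⁺-target : ∀ {M} N₀ → M ▷β (N₀ ⁺) → Σ Tm λ M₀ → M ≡ M₀ ⁺ × M₀ ▷β N₀
▷β-⁺-target {M} N₀ s with unshift M (Pos-▷β⁻¹ s (Pos-⁺ N₀))
... | M₀ , refl with ⁺-reflects-▷β s M₀ refl
... | N₀' , e , s' with ⁺-inj N₀ N₀' e
... | refl = M₀ , refl , s'

FV-▷β⁻¹ : ∀ {M N} → M ▷β N → ∀ {y m} → (y , m) ∈FV N → (y , m) ∈FV M
FV-▷β⁻¹ (β {n} {_} {A} (term-app (term-lam {B} {x} {n} tB i) tA j) e) k
  rewrite inst-close x n A B (Term-LC tB) with FV-subst⇒ x n A B k
... | inj₁ (a , b) = fv-appˡ (fv-lam (FV-close⇐ 0 x n B a b))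
... | inj₂ (a , b) = fv-appʳ a
FV-▷β⁻¹ (ξ-lam {M} {N} {x} {n} s i j) (fv-lam k) =
  let a , b = FV-close⇒ 0 x n N k in fv-lam (FV-close⇐ 0 x n M (FV-▷β⁻¹ s a) b)
FV-▷β⁻¹ (ξ-appˡ s t j1 j2) (fv-appˡ k) = fv-appˡ (FV-▷β⁻¹ s k)
FV-▷β⁻¹ (ξ-appˡ s t j1 j2) (fv-appʳ k) = fv-appʳ k
FV-▷β⁻¹ (ξ-appʳ s t j1 j2) (fv-appˡ k) = fv-appˡ k
FV-▷β⁻¹ (ξ-appʳ s t j1 j2) (fv-appʳ k) = fv-appʳ (FV-▷β⁻¹ s k)

FV-▷β : ∀ {M N} → M ▷β N → ∀ {y m} → (y , m) ∈FV M → (y , m) ∈FV N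
FV-▷β (β {n} {_} {A} (term-app (term-lam {B} {x} {n} tB i) tA j) e) k
  rewrite inst-close x n A B (Term-LC tB) with k
... | fv-appˡ (fv-lam k') = let a , b = FV-close⇒ 0 x n B k' in FV-subst⇐M x n A B a b
... | fv-appʳ k'          = FV-subst⇐A x n A B i k'
FV-▷β (ξ-lam {M} {N} {x} {n} s i j) (fv-lam k) =
  let a , b = FV-close⇒ 0 x n M k in fv-lam (FV-close⇐ 0 x n N (FV-▷β s a) b)
FV-▷β (ξ-appˡ s t j1 j2) (fv-appˡ k) = fv-appˡ (FV-▷β s k)
FV-▷β (ξ-appˡ s t j1 j2) (fv-appʳ k) = fv-appʳ k
FV-▷β (ξ-appʳ s t j1 j2) (fv-appˡ k) = fv-appˡ k
FV-▷β (ξ-appʳ s t j1 j2) (fv-appʳ k) = fv-appʳ (FV-▷β s k)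

▷β-LC : ∀ {M N} → M ▷β N → LC 0 N
▷β-LC (β {n} {_} {A} (term-app (term-lam {B} {x} {n} tB i) tA j) e)
  rewrite inst-close x n A B (Term-LC tB) = substN-LC 0 x n A B (Term-LC tB) (Term-LC tA)
▷β-LC (ξ-lam {M} {N} {x} {n} s i j) = LC-close 0 x n N (▷β-LC s)
▷β-LC (ξ-appˡ s t j1 j2) = ▷β-LC s , Term-LC t
▷β-LC (ξ-appʳ s t j1 j2) = Term-LC t , ▷β-LC s

▷β-binder-fresh : ∀ {M N x n} → M ▷β N → Term M → (x , n) ∈FV M → NoName x (close x n N)
▷β-binder-fresh {N = N} {x} {n} s tM i k h =
  let a , b = FV-close⇒ 0 x n N h in b (refl , Term-self-joinable tM x k n (FV-▷β⁻¹ s a) i)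
-- Elements of 𝕋 have degree 0; degree and goodness are invariant
-- under the equality ≈ of types, and ⊑ preserves degree and goodness in both
-- directions (goodness of the smaller type is what ⊑-∩ˡ demands).

degT≡0 : ∀ T → degT T ≡ 0
degT≡0 (atom a) = refl
degT≡0 (U ⇒ T) rewrite degT≡0 T = ⊓-zeroʳ (degU U)

degT-≈ : ∀ {T T'} → T ≈T T' → degT T ≡ degT T'
degT-≈ {T} {T'} _ = trans (degT≡0 T) (sym (degT≡0 T'))

degU-≈ : ∀ {U V} → U ≈U V → degU U ≡ degU V
degU-≈ ≈U-refl = refl
degU-≈ (≈U-sym p) = sym (degU-≈ p)
degU-≈ (≈U-trans p q) = trans (degU-≈ p) (degU-≈ q)
degU-≈ (≈U-∩ p q) = cong₂ _⊓_ (degU-≈ p) (degU-≈ q)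
degU-≈ (≈U-ex p) = cong suc (degU-≈ p)
degU-≈ (≈U-⌜⌝ p) = degT-≈ p
degU-≈ (∩-comm {U} {V}) = ⊓-comm (degU U) (degU V)
degU-≈ (∩-assoc {U} {V} {W}) = ⊓-assoc (degU U) (degU V) (degU W)
degU-≈ (∩-idem {U}) = ⊓-idem (degU U)
degU-≈ ex-dist = refl

-- Arrow types are good as soon as their parts are, since degT T = 0.
good-⇒′ : ∀ {U T} → GoodU U → GoodT T → GoodT (U ⇒ T)
good-⇒′ {U} {T} g h = good-⇒ g h (subst (_≤ degU U) (sym (degT≡0 T)) z≤n)

mutual
  goodT-≈ : ∀ {T T'} → T ≈T T' → (GoodT T → GoodT T') × (GoodT T' → GoodT T)
  goodT-≈ ≈T-refl = (λ x → x) , (λ x → x)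
  goodT-≈ (≈T-sym p) = let a , b = goodT-≈ p in b , a
  goodT-≈ (≈T-trans p q) = let a , b = goodT-≈ p ; c , d = goodT-≈ q in (λ x → c (a x)) , (λ x → b (d x))
  goodT-≈ (≈T-⇒ p q) = let a , b = goodU-≈ p ; c , d = goodT-≈ q in
    (λ { (good-⇒ g h _) → good-⇒′ (a g) (c h) }) , (λ { (good-⇒ g h _) → good-⇒′ (b g) (d h) })

  goodU-≈ : ∀ {U V} → U ≈U V → (GoodU U → GoodU V) × (GoodU V → GoodU U)
  goodU-≈ ≈U-refl = (λ x → x) , (λ x → x)
  goodU-≈ (≈U-sym p) = let a , b = goodU-≈ p in b , a
  goodU-≈ (≈U-trans p q) = let a , b = goodU-≈ p ; c , d = goodU-≈ q in (λ x → c (a x)) , (λ x → b (d x))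
  goodU-≈ (≈U-∩ p q) = let a , b = goodU-≈ p ; c , d = goodU-≈ q in
    (λ { (good-∩ g h e) → good-∩ (a g) (c h) (trans (sym (degU-≈ p)) (trans e (degU-≈ q))) }) ,
    (λ { (good-∩ g h e) → good-∩ (b g) (d h) (trans (degU-≈ p) (trans e (sym (degU-≈ q)))) })
  goodU-≈ (≈U-ex p) = let a , b = goodU-≈ p in (λ { (good-ex g) → good-ex (a g) }) , (λ { (good-ex g) → good-ex (b g) })
  goodU-≈ (≈U-⌜⌝ p) = let a , b = goodT-≈ p in (λ { (good-⌜⌝ g) → good-⌜⌝ (a g) }) , (λ { (good-⌜⌝ g) → good-⌜⌝ (b g) })
  goodU-≈ ∩-comm = (λ { (good-∩ g h e) → good-∩ h g (sym e) }) , (λ { (good-∩ g h e) → good-∩ h g (sym e) })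
  goodU-≈ (∩-assoc {U} {V} {W}) = f , g
    where
    f : GoodU ((U ∩ V) ∩ W) → GoodU (U ∩ (V ∩ W))
    f (good-∩ (good-∩ a b e1) c e2) =
      let e3 : degU V ≡ degU W
          e3 = trans (sym (trans (cong (_⊓ degU V) e1) (⊓-idem (degU V)))) e2
      in good-∩ a (good-∩ b c e3) (trans e1 (sym (trans (cong (degU V ⊓_) (sym e3)) (⊓-idem (degU V)))))
    g : GoodU (U ∩ (V ∩ W)) → GoodU ((U ∩ V) ∩ W)
    g (good-∩ a (good-∩ b c e1) e2) =
      let e3 : degU U ≡ degU V
          e3 = trans e2 (trans (cong (degU V ⊓_) (sym e1)) (⊓-idem (degU V)))
      in good-∩ (good-∩ a b e3) c (trans (cong (_⊓ degU V) e3) (trans (⊓-idem (degU V)) e1))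
  goodU-≈ (∩-idem {U}) = (λ { (good-∩ g h e) → g }) , (λ g → good-∩ g g refl)
  goodU-≈ ex-dist = (λ { (good-ex (good-∩ g h e)) → good-∩ (good-ex g) (good-ex h) (cong suc e) }) ,
                   (λ { (good-∩ (good-ex g) (good-ex h) e) → good-ex (good-∩ g h (suc-injective e)) })

degU-⊑ : ∀ {U V} → U ⊑ V → degU U ≡ degU V
degU-⊑ (⊑-refl p) = degU-≈ p
degU-⊑ (⊑-trans p q) = trans (degU-⊑ p) (degU-⊑ q)
degU-⊑ (⊑-∩ˡ {U₁} g e) rewrite e = ⊓-idem _
degU-⊑ (⊑-∩ p q) = cong₂ _⊓_ (degU-⊑ p) (degU-⊑ q)
degU-⊑ (⊑-⇒ {U₁} {U₂} {T₁} {T₂} p q) = trans (degT≡0 (U₁ ⇒ T₁)) (sym (degT≡0 (U₂ ⇒ T₂)))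
degU-⊑ (⊑-ex p) = cong suc (degU-⊑ p)

mutual
  good-⊑ : ∀ {U V} → U ⊑ V → GoodU U → GoodU V
  good-⊑ (⊑-refl p) g = proj₁ (goodU-≈ p) g
  good-⊑ (⊑-trans p q) g = good-⊑ q (good-⊑ p g)
  good-⊑ (⊑-∩ˡ h e) (good-∩ g _ _) = g
  good-⊑ (⊑-∩ p q) (good-∩ g h e) = good-∩ (good-⊑ p g) (good-⊑ q h) (trans (sym (degU-⊑ p)) (trans e (degU-⊑ q)))
  good-⊑ (⊑-⇒ p q) (good-⌜⌝ (good-⇒ g h _)) with good-⊑ q (good-⌜⌝ h)
  ... | good-⌜⌝ h' = good-⌜⌝ (good-⇒′ (good-⊒ p g) h')
  good-⊑ (⊑-ex p) (good-ex g) = good-ex (good-⊑ p g)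

  good-⊒ : ∀ {U V} → U ⊑ V → GoodU V → GoodU U
  good-⊒ (⊑-refl p) g = proj₂ (goodU-≈ p) g
  good-⊒ (⊑-trans p q) g = good-⊒ p (good-⊒ q g)
  good-⊒ (⊑-∩ˡ h e) g = good-∩ g h e
  good-⊒ (⊑-∩ p q) (good-∩ g h e) = good-∩ (good-⊒ p g) (good-⊒ q h) (trans (degU-⊑ p) (trans e (sym (degU-⊑ q))))
  good-⊒ (⊑-⇒ p q) (good-⌜⌝ (good-⇒ g h _)) with good-⊒ q (good-⌜⌝ h)
  ... | good-⌜⌝ h' = good-⌜⌝ (good-⇒′ (good-⊑ p g) h')
  good-⊒ (⊑-ex p) (good-ex g) = good-ex (good-⊒ p g)

-- Up to ≈, a type is an intersection of types e₁…eₖ T with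
-- T ∈ 𝕋; comps lists these pairs (e₁…eₖ , T).  Covers U V says that every component of V is above a component of
-- U; it is a preorder implied by ⊑, so ⊑ never creates new components.

Comp : Set
Comp = List ℕ × TT

pre : ℕ → Comp → Comp
pre e (p , T) = (e ∷ p , T)

comps : UU → List Comp
comps (U ∩ V) = comps U ++ comps V
comps (ex e U) = map (pre e) (comps U)
comps ⌜ T ⌝ = ([] , T) ∷ []

_≤T_ : TT → TT → Set
atom a ≤T atom b = a ≡ b
(U ⇒ T) ≤T (U' ⇒ T') = (U' ⊑ U) × (⌜ T ⌝ ⊑ ⌜ T' ⌝)
atom _ ≤T (_ ⇒ _) = ⊥
(_ ⇒ _) ≤T atom _ = ⊥

_≤c_ : Comp → Comp → Set
(p , T) ≤c (q , T') = p ≡ q × T ≤T T'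

≤T-refl : ∀ T → T ≤T T
≤T-refl (atom a) = refl
≤T-refl (U ⇒ T) = ⊑-refl ≈U-refl , ⊑-refl ≈U-refl

≤T-trans : ∀ T₁ T₂ T₃ → T₁ ≤T T₂ → T₂ ≤T T₃ → T₁ ≤T T₃
≤T-trans (atom a) (atom b) (atom c) p q = trans p q
≤T-trans (U₁ ⇒ T₁) (U₂ ⇒ T₂) (U₃ ⇒ T₃) (p , q) (p' , q') = ⊑-trans p' p , ⊑-trans q q'
≤T-trans (atom _) (atom _) (_ ⇒ _) p ()
≤T-trans (atom _) (_ ⇒ _) _ () q
≤T-trans (_ ⇒ _) (atom _) _ () q
≤T-trans (_ ⇒ _) (_ ⇒ _) (atom _) p ()

≤c-refl : ∀ c → c ≤c c
≤c-refl (p , T) = refl , ≤T-refl T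

≤c-trans : ∀ c₁ c₂ c₃ → c₁ ≤c c₂ → c₂ ≤c c₃ → c₁ ≤c c₃
≤c-trans (p₁ , T₁) (p₂ , T₂) (p₃ , T₃) (a , b) (c , d) = trans a c , ≤T-trans T₁ T₂ T₃ b d

≤T⇒⊑ : ∀ T T' → T ≤T T' → ⌜ T ⌝ ⊑ ⌜ T' ⌝
≤T⇒⊑ (atom a) (atom b) refl = ⊑-refl ≈U-refl
≤T⇒⊑ (U ⇒ T) (U' ⇒ T') (p , q) = ⊑-⇒ p q

record Covers (U V : UU) : Set where
  constructor covers
  field covering : ∀ {c'} → c' ∈ comps V → ∃ λ c → c ∈ comps U × c ≤c c'
open Covers public

Covers-⊇ : ∀ {U V} → (∀ {c} → c ∈ comps V → c ∈ comps U) → Covers U V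
Covers-⊇ f = covers λ {c'} i → c' , f i , ≤c-refl c'

Covers-refl : ∀ {U} → Covers U U
Covers-refl = Covers-⊇ (λ i → i)

Covers-trans : ∀ {U V W} → Covers U V → Covers V W → Covers U W
Covers-trans {U} {V} {W} r s = covers λ {c''} i → go i
  where
  go : ∀ {c''} → c'' ∈ comps W → ∃ λ c → c ∈ comps U × c ≤c c''
  go {c''} i with covering s i
  ... | c' , i' , le' with covering r i'
  ... | c , i'' , le = c , i'' , ≤c-trans c c' c'' le le'

≈T⇒≤T : ∀ {T T'} → T ≈T T' → T ≤T T' × T' ≤T T
≈T⇒≤T {T} ≈T-refl = ≤T-refl T , ≤T-refl T
≈T⇒≤T (≈T-sym p) = let a , b = ≈T⇒≤T p in b , a
≈T⇒≤T {T₁} {T₃} (≈T-trans {T₂ = T₂} p q) = let a , b = ≈T⇒≤T p ; c , d = ≈T⇒≤T q in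
  ≤T-trans T₁ T₂ T₃ a c , ≤T-trans T₃ T₂ T₁ d b
≈T⇒≤T (≈T-⇒ p q) = (⊑-refl (≈U-sym p) , ⊑-refl (≈U-⌜⌝ q)) , (⊑-refl p , ⊑-refl (≈U-⌜⌝ (≈T-sym q)))

Covers-∩ : ∀ {U₁ U₂ V₁ V₂} → Covers U₁ V₁ → Covers U₂ V₂ → Covers (U₁ ∩ U₂) (V₁ ∩ V₂)
Covers-∩ {U₁} {U₂} {V₁} {V₂} r s = covers go
  where
  go : ∀ {c'} → c' ∈ comps (V₁ ∩ V₂) → ∃ λ c → c ∈ comps (U₁ ∩ U₂) × c ≤c c'
  go i with ∈-++⁻ (comps V₁) i
  ... | inj₁ j = let c , k , le = covering r j in c , ∈-++⁺ˡ k , le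
  ... | inj₂ j = let c , k , le = covering s j in c , ∈-++⁺ʳ (comps U₁) k , le

Covers-ex : ∀ {e U V} → Covers U V → Covers (ex e U) (ex e V)
Covers-ex {e} {U} {V} r = covers go
  where
  go : ∀ {c'} → c' ∈ comps (ex e V) → ∃ λ c → c ∈ comps (ex e U) × c ≤c c'
  go i with ∈-map⁻ (pre e) i
  ... | c' , j , refl = let c , k , (a , b) = covering r j in pre e c , ∈-map⁺ (pre e) k , cong (e ∷_) a , b

Covers-≈ : ∀ {U V} → U ≈U V → Covers U V × Covers V U
Covers-≈ ≈U-refl = Covers-refl , Covers-refl
Covers-≈ (≈U-sym p) = let a , b = Covers-≈ p in b , a
Covers-≈ (≈U-trans p q) = let a , b = Covers-≈ p ; c , d = Covers-≈ q in Covers-trans a c , Covers-trans d b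
Covers-≈ (≈U-∩ p q) = let a , b = Covers-≈ p ; c , d = Covers-≈ q in Covers-∩ a c , Covers-∩ b d
Covers-≈ (≈U-ex p) = let a , b = Covers-≈ p in Covers-ex a , Covers-ex b
Covers-≈ (≈U-⌜⌝ {T} {T'} p) = let a , b = ≈T⇒≤T p in
  covers (λ { (here refl) → ([] , T) , here refl , refl , a ; (there ()) }) ,
  covers (λ { (here refl) → ([] , T') , here refl , refl , b ; (there ()) })
Covers-≈ (∩-comm {U} {V}) = Covers-⊇ (swap-sides U V) , Covers-⊇ (swap-sides V U)
  where
  swap-sides : ∀ U V → ∀ {c} → c ∈ comps (V ∩ U) → c ∈ comps (U ∩ V)
  swap-sides U V {c} i with ∈-++⁻ (comps V) i
  ... | inj₁ j = ∈-++⁺ʳ (comps U) j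
  ... | inj₂ j = ∈-++⁺ˡ j
Covers-≈ (∩-assoc {U} {V} {W}) = Covers-⊇ f , Covers-⊇ g
  where
  f : ∀ {c} → c ∈ comps (U ∩ (V ∩ W)) → c ∈ comps ((U ∩ V) ∩ W)
  f i with ∈-++⁻ (comps U) i
  ... | inj₁ j = ∈-++⁺ˡ (∈-++⁺ˡ j)
  ... | inj₂ j with ∈-++⁻ (comps V) j
  ...   | inj₁ k = ∈-++⁺ˡ (∈-++⁺ʳ (comps U) k)
  ...   | inj₂ k = ∈-++⁺ʳ (comps U ++ comps V) k
  g : ∀ {c} → c ∈ comps ((U ∩ V) ∩ W) → c ∈ comps (U ∩ (V ∩ W))
  g i with ∈-++⁻ (comps U ++ comps V) i
  ... | inj₂ j = ∈-++⁺ʳ (comps U) (∈-++⁺ʳ (comps V) j)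
  ... | inj₁ j with ∈-++⁻ (comps U) j
  ...   | inj₁ k = ∈-++⁺ˡ k
  ...   | inj₂ k = ∈-++⁺ʳ (comps U) (∈-++⁺ˡ k)
Covers-≈ (∩-idem {U}) = Covers-⊇ (λ i → ∈-++⁺ˡ i) , Covers-⊇ f
  where
  f : ∀ {c} → c ∈ comps (U ∩ U) → c ∈ comps U
  f i with ∈-++⁻ (comps U) i
  ... | inj₁ j = j
  ... | inj₂ j = j
Covers-≈ (ex-dist {e} {U} {V}) = Covers-⊇ (λ {c} i → subst (c ∈_) (sym (map-++ (pre e) (comps U) (comps V))) i) ,
                            Covers-⊇ (λ {c} i → subst (c ∈_) (map-++ (pre e) (comps U) (comps V)) i)

⊑⇒Covers : ∀ {U V} → U ⊑ V → Covers U V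
⊑⇒Covers (⊑-refl p) = proj₁ (Covers-≈ p)
⊑⇒Covers (⊑-trans p q) = Covers-trans (⊑⇒Covers p) (⊑⇒Covers q)
⊑⇒Covers (⊑-∩ˡ g e) = Covers-⊇ ∈-++⁺ˡ
⊑⇒Covers (⊑-∩ p q) = Covers-∩ (⊑⇒Covers p) (⊑⇒Covers q)
⊑⇒Covers (⊑-⇒ {U₁} {U₂} {T₁} {T₂} p q) = covers λ { (here refl) → ([] , U₁ ⇒ T₁) , here refl , refl , p , q ; (there ()) }
⊑⇒Covers (⊑-ex p) = Covers-ex (⊑⇒Covers p)

comps-ex-prefixed : ∀ e U {T} → ([] , T) ∈ comps (ex e U) → ⊥
comps-ex-prefixed e U i with ∈-map⁻ (pre e) i
... | c , j , ()

_≐_ : Env → Env → Set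
Γ ≐ Γ' = ∀ y m → Γ y m ≡ Γ' y m

≐-sym : ∀ {Γ Γ'} → Γ ≐ Γ' → Γ' ≐ Γ
≐-sym e y m = sym (e y m)

var? : ∀ w k x n → Dec (w ≡ x × k ≡ n)
var? w k x n = (w ≟ x) ×-dec (k ≟ n)

⊑M-refl : ∀ a → ⊑M a a
⊑M-refl nothing  = nothing
⊑M-refl (just U) = just (⊑-refl ≈U-refl)

⊑M-trans : ∀ {a b c} → ⊑M a b → ⊑M b c → ⊑M a c
⊑M-trans nothing  nothing  = nothing
⊑M-trans (just p) (just q) = just (⊑-trans p q)

⊑M-just : ∀ {W b} → ⊑M (just W) b → Σ UU λ W' → b ≡ just W' × W ⊑ W'
⊑M-just (just p) = _ , refl , p

⊑M-just' : ∀ {a W} → ⊑M a (just W) → Σ UU λ W' → a ≡ just W' × W' ⊑ W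
⊑M-just' (just p) = _ , refl , p

⊑M-meet-nothing : ∀ {U} a → ⊑M (just U) (meetM a nothing) → Σ UU λ U'' → a ≡ just U'' × U ⊑ U''
⊑M-meet-nothing (just U'') (just r) = U'' , refl , r

⊑M-glb : ∀ {a b c} → ⊑M a b → ⊑M a c → ⊑M a (meetM b c)
⊑M-glb nothing  nothing  = nothing
⊑M-glb (just p) (just q) = just (⊑-trans (⊑-refl (≈U-sym ∩-idem)) (⊑-∩ p q))

⊑M-meet : ∀ {a b c d} → ⊑M a b → ⊑M c d → ⊑M (meetM a c) (meetM b d)
⊑M-meet nothing  nothing  = nothing
⊑M-meet nothing  (just q) = just q
⊑M-meet (just p) nothing  = just p
⊑M-meet (just p) (just q) = just (⊑-∩ p q)

⊑ₑ-refl : ∀ {Γ} → Γ ⊑ₑ Γ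
⊑ₑ-refl {Γ} y m = ⊑M-refl (Γ y m)

⊑ₑ-trans : ∀ {Γ₁ Γ₂ Γ₃} → Γ₁ ⊑ₑ Γ₂ → Γ₂ ⊑ₑ Γ₃ → Γ₁ ⊑ₑ Γ₃
⊑ₑ-trans p q y m = ⊑M-trans (p y m) (q y m)

≐⇒⊑ : ∀ {Γ Γ'} → Γ ≐ Γ' → Γ ⊑ₑ Γ'
≐⇒⊑ {Γ} e y m rewrite e y m = ⊑M-refl _

⊑ₑ-≐ : ∀ {Δ X Y} → Δ ⊑ₑ X → X ≐ Y → Δ ⊑ₑ Y
⊑ₑ-≐ {Δ} p e y m = subst (⊑M (Δ y m)) (e y m) (p y m)

≐-⊑ₑ : ∀ {Δ X Y} → X ≐ Y → X ⊑ₑ Δ → Y ⊑ₑ Δ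
≐-⊑ₑ {Δ} e p y m = subst (λ z → ⊑M z (Δ y m)) (e y m) (p y m)

⊑ₑ-glb : ∀ {Δ X Y} → Δ ⊑ₑ X → Δ ⊑ₑ Y → Δ ⊑ₑ (X ⊓ₑ Y)
⊑ₑ-glb p q y m = ⊑M-glb (p y m) (q y m)

⊑ₑ-meet : ∀ {Γ₁ Γ₂ Δ₁ Δ₂} → Γ₁ ⊑ₑ Δ₁ → Γ₂ ⊑ₑ Δ₂ → (Γ₁ ⊓ₑ Γ₂) ⊑ₑ (Δ₁ ⊓ₑ Δ₂)
⊑ₑ-meet p q y m = ⊑M-meet (p y m) (q y m)

meet-l : ∀ a b {U} → a ≡ just U → Σ UU λ W → meetM a b ≡ just W
meet-l (just U) (just V) refl = _ , refl
meet-l (just U) nothing  refl = _ , refl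

meet-r : ∀ a b {U} → b ≡ just U → Σ UU λ W → meetM a b ≡ just W
meet-r (just U) (just V) refl = _ , refl
meet-r nothing  (just V) refl = _ , refl

meet-just : ∀ a b {W} → meetM a b ≡ just W → (Σ UU λ U → a ≡ just U) ⊎ (Σ UU λ V → b ≡ just V)
meet-just (just U) b        e = inj₁ (U , refl)
meet-just nothing  (just V) e = inj₂ (V , refl)

ext-at : ∀ Γ x n U → (Γ ,[ x , n ]∶ U) x n ≡ just U
ext-at Γ x n U rewrite sameVar-refl x n = refl

ext-other : ∀ Γ x n U y m → ¬ (y ≡ x × m ≡ n) → (Γ ,[ x , n ]∶ U) y m ≡ Γ y m
ext-other Γ x n U y m ne rewrite sameVar-distinct ne = refl

ext-inv : ∀ Γ x n U y m {W} → (Γ ,[ x , n ]∶ U) y m ≡ just W →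
  (y ≡ x × m ≡ n × W ≡ U) ⊎ (¬ (y ≡ x × m ≡ n) × Γ y m ≡ just W)
ext-inv Γ x n U y m e with sameVar y m x n | sameVar-view y m x n
ext-inv Γ x n U y m refl | true  | same p q   = inj₁ (p , q , refl)
...                      | false | distinct p = inj₂ (p , e)

ext-cong : ∀ {X Y} a b U → X ≐ Y → (X ,[ a , b ]∶ U) ≐ (Y ,[ a , b ]∶ U)
ext-cong a b U p w k = cong (λ t → if sameVar w k a b then just U else t) (p w k)

data ≈M : Maybe UU → Maybe UU → Set where
  nothing : ≈M nothing nothing
  just    : ∀ {U V} → U ≈U V → ≈M (just U) (just V)

≈M-refl : ∀ a → ≈M a a
≈M-refl nothing  = nothing
≈M-refl (just U) = just ≈U-refl

≈M-sym : ∀ {a b} → ≈M a b → ≈M b a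
≈M-sym nothing  = nothing
≈M-sym (just p) = just (≈U-sym p)

≈M-trans : ∀ {a b c} → ≈M a b → ≈M b c → ≈M a c
≈M-trans nothing  nothing  = nothing
≈M-trans (just p) (just q) = just (≈U-trans p q)

≈M⇒⊑M : ∀ {a b} → ≈M a b → ⊑M a b
≈M⇒⊑M nothing  = nothing
≈M⇒⊑M (just p) = just (⊑-refl p)

≡⇒≈M : ∀ {a b} → a ≡ b → ≈M a b
≡⇒≈M {a} refl = ≈M-refl a

meet-comm : ∀ a b → ≈M (meetM a b) (meetM b a)
meet-comm (just U) (just V) = just ∩-comm
meet-comm (just U) nothing  = just ≈U-refl
meet-comm nothing  (just V) = just ≈U-refl
meet-comm nothing  nothing  = nothing

meet-assoc : ∀ a b c → ≈M (meetM (meetM a b) c) (meetM a (meetM b c))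
meet-assoc (just U) (just V) (just W) = just ∩-assoc
meet-assoc (just U) (just V) nothing  = just ≈U-refl
meet-assoc (just U) nothing  (just W) = just ≈U-refl
meet-assoc (just U) nothing  nothing  = just ≈U-refl
meet-assoc nothing  (just V) (just W) = just ≈U-refl
meet-assoc nothing  (just V) nothing  = just ≈U-refl
meet-assoc nothing  nothing  (just W) = just ≈U-refl
meet-assoc nothing  nothing  nothing  = nothing

meet-idem : ∀ a → ≈M (meetM a a) a
meet-idem (just U) = just ∩-idem
meet-idem nothing  = nothing

meet-cong : ∀ {a a' b b'} → ≈M a a' → ≈M b b' → ≈M (meetM a b) (meetM a' b')
meet-cong nothing  nothing  = nothing
meet-cong nothing  (just q) = just q
meet-cong (just p) nothing  = just p
meet-cong (just p) (just q) = just (≈U-∩ p q)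

meet-swap : ∀ a b d → ≈M (meetM (meetM a d) b) (meetM (meetM a b) d)
meet-swap a b d =
  ≈M-trans (meet-assoc a d b) (≈M-trans (meet-cong (≈M-refl a) (meet-comm d b)) (≈M-sym (meet-assoc a b d)))

meet-interchange : ∀ a b c d → ≈M (meetM (meetM a c) (meetM b d)) (meetM (meetM a b) (meetM c d))
meet-interchange a b c d =
  ≈M-trans (meet-assoc a c (meetM b d))
  (≈M-trans (meet-cong (≈M-refl a) (≈M-trans (≈M-sym (meet-assoc c b d))
                                   (≈M-trans (meet-cong (meet-comm c b) (≈M-refl d)) (meet-assoc b c d))))
  (≈M-sym (meet-assoc a b (meetM c d))))

_≈ₑ_ : Env → Env → Set
Γ ≈ₑ Γ' = ∀ y m → ≈M (Γ y m) (Γ' y m)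

≈ₑ⇒⊑ₑ : ∀ {Γ Γ'} → Γ ≈ₑ Γ' → Γ ⊑ₑ Γ'
≈ₑ⇒⊑ₑ p y m = ≈M⇒⊑M (p y m)

≈ₑ-sym : ∀ {Γ Γ'} → Γ ≈ₑ Γ' → Γ' ≈ₑ Γ
≈ₑ-sym p y m = ≈M-sym (p y m)

rem : ℕ → ℕ → Env → Env
rem y n Γ z m = if sameVar z m y n then nothing else Γ z m

rem-at : ∀ y n Γ → rem y n Γ y n ≡ nothing
rem-at y n Γ rewrite sameVar-refl y n = refl

rem-other : ∀ y n Γ z m → ¬ (z ≡ y × m ≡ n) → rem y n Γ z m ≡ Γ z m
rem-other y n Γ z m ne rewrite sameVar-distinct ne = refl

rem-just : ∀ y n Γ z m {W} → rem y n Γ z m ≡ just W → ¬ (z ≡ y × m ≡ n) × Γ z m ≡ just W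
rem-just y n Γ z m e with sameVar z m y n | sameVar-view z m y n
rem-just y n Γ z m () | true  | _
rem-just y n Γ z m e  | false | distinct p = p , e

rem-nothing : ∀ y n Γ w m → Γ w m ≡ nothing → rem y n Γ w m ≡ nothing
rem-nothing y n Γ w m e with sameVar w m y n
... | true  = refl
... | false = e

rem-notin : ∀ y n Γ → Γ y n ≡ nothing → rem y n Γ ≐ Γ
rem-notin y n Γ h z m with sameVar z m y n | sameVar-view z m y n
... | true  | same refl refl = sym h
... | false | _              = refl

rem-⊓ : ∀ y n Γ₁ Γ₂ → rem y n (Γ₁ ⊓ₑ Γ₂) ≐ (rem y n Γ₁ ⊓ₑ rem y n Γ₂)
rem-⊓ y n Γ₁ Γ₂ z m with sameVar z m y n
... | true  = refl
... | false = refl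

rem-⊑ : ∀ y n {Γ Γ'} → Γ ⊑ₑ Γ' → rem y n Γ ⊑ₑ rem y n Γ'
rem-⊑ y n p z m with sameVar z m y n
... | true  = nothing
... | false = p z m

rem-ext : ∀ y n Γ x n₁ U w m → ¬ (w ≡ x × m ≡ n₁) → rem y n (Γ ,[ x , n₁ ]∶ U) w m ≡ rem y n Γ w m
rem-ext y n Γ x n₁ U w m ne with sameVar w m y n
... | true  = refl
... | false = ext-other Γ x n₁ U w m ne

rem-rem : ∀ y n v m X w k → ¬ (w ≡ v × k ≡ m) → rem y n (rem v m X) w k ≡ rem y n X w k
rem-rem y n v m X w k ne with sameVar w k y n
... | true  = refl
... | false = rem-other v m X w k ne

rem-ext-inverse : ∀ Γ x n U → Γ x n ≡ nothing → rem x n (Γ ,[ x , n ]∶ U) ≐ Γ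
rem-ext-inverse Γ x n U e w m with sameVar w m x n | sameVar-view w m x n
... | true  | same refl refl = sym e
... | false | _              = refl

rem-ext-split : ∀ Θ x n {W} → Θ x n ≡ just W → Θ ≐ (rem x n Θ ,[ x , n ]∶ W)
rem-ext-split Θ x n {W} h w k with var? w k x n
... | yes (refl , refl) = trans h (sym (ext-at (rem x n Θ) x n W))
... | no ne = sym (trans (ext-other (rem x n Θ) x n W w k ne) (rem-other x n Θ w k ne))

exₑ-cong : ∀ e {Γ Γ'} → Γ ≐ Γ' → exₑ e Γ ≐ exₑ e Γ'
exₑ-cong e p y zero    = refl
exₑ-cong e p y (suc m) = cong (Maybe.map (ex e)) (p y m)

⊑ₑ-ex : ∀ {Γ Γ'} e → Γ ⊑ₑ Γ' → exₑ e Γ ⊑ₑ exₑ e Γ'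
⊑ₑ-ex e p y zero = nothing
⊑ₑ-ex {Γ} {Γ'} e p y (suc m) with Γ y m | Γ' y m | p y m
... | just U  | just V  | just q  = just (⊑-ex q)
... | nothing | nothing | nothing = nothing

exₑ-⊓ : ∀ e Γ₁ Γ₂ → (exₑ e Γ₁ ⊓ₑ exₑ e Γ₂) ⊑ₑ exₑ e (Γ₁ ⊓ₑ Γ₂)
exₑ-⊓ e Γ₁ Γ₂ y zero = nothing
exₑ-⊓ e Γ₁ Γ₂ y (suc m) with Γ₁ y m | Γ₂ y m
... | just U  | just V  = just (⊑-refl (≈U-sym ex-dist))
... | just U  | nothing = just (⊑-refl ≈U-refl)
... | nothing | just V  = just (⊑-refl ≈U-refl)
... | nothing | nothing = nothing

exₑ-⊓' : ∀ e Γ₁ Γ₂ → exₑ e (Γ₁ ⊓ₑ Γ₂) ⊑ₑ (exₑ e Γ₁ ⊓ₑ exₑ e Γ₂)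
exₑ-⊓' e Γ₁ Γ₂ y zero = nothing
exₑ-⊓' e Γ₁ Γ₂ y (suc m) with Γ₁ y m | Γ₂ y m
... | just U  | just V  = just (⊑-refl ex-dist)
... | just U  | nothing = just (⊑-refl ≈U-refl)
... | nothing | just V  = just (⊑-refl ≈U-refl)
... | nothing | nothing = nothing

rem-ex : ∀ y n e Γ → rem y (suc n) (exₑ e Γ) ≐ exₑ e (rem y n Γ)
rem-ex y n e Γ z zero with sameVar z zero y (suc n)
... | true  = refl
... | false = refl
rem-ex y n e Γ z (suc m) with sameVar z m y n
... | true  = refl
... | false = refl

exsₑ : List ℕ → Env → Env
exsₑ []      Γ = Γ
exsₑ (e ∷ p) Γ = exₑ e (exsₑ p Γ)

exs-snoc : ∀ q f X → exsₑ (q ++ f ∷ []) X ≐ exsₑ q (exₑ f X)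
exs-snoc []      f X y m = refl
exs-snoc (e ∷ q) f X     = exₑ-cong e (exs-snoc q f X)

exs-⊓ : ∀ q Γ₁ Γ₂ → (exsₑ q Γ₁ ⊓ₑ exsₑ q Γ₂) ⊑ₑ exsₑ q (Γ₁ ⊓ₑ Γ₂)
exs-⊓ []      Γ₁ Γ₂ = ⊑ₑ-refl
exs-⊓ (e ∷ q) Γ₁ Γ₂ = ⊑ₑ-trans (exₑ-⊓ e (exsₑ q Γ₁) (exsₑ q Γ₂)) (⊑ₑ-ex e (exs-⊓ q Γ₁ Γ₂))

swapₑ : ℕ → ℕ → Env → Env
swapₑ a b Γ y m = Γ (swapℕ a b y) m

sameVar-swapʳ : ∀ a b y m x n → sameVar y m (swapℕ a b x) n ≡ sameVar (swapℕ a b y) m x n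
sameVar-swapʳ a b y m x n =
  trans (cong (λ z → sameVar z m (swapℕ a b x) n) (sym (swapℕ-invol a b y))) (sameVar-swap a b (swapℕ a b y) m x n)

swapₑ-ext : ∀ a b Γ x n U → swapₑ a b (Γ ,[ x , n ]∶ U) ≐ (swapₑ a b Γ ,[ swapℕ a b x , n ]∶ U)
swapₑ-ext a b Γ x n U y m = cong (λ t → if t then just U else Γ (swapℕ a b y) m) (sym (sameVar-swapʳ a b y m x n))

swapₑ-ex : ∀ a b e Γ → swapₑ a b (exₑ e Γ) ≐ exₑ e (swapₑ a b Γ)
swapₑ-ex a b e Γ y zero    = refl
swapₑ-ex a b e Γ y (suc m) = refl

swapₑ-rem : ∀ a b y n Γ → swapₑ a b (rem y n Γ) ≐ rem (swapℕ a b y) n (swapₑ a b Γ)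
swapₑ-rem a b y n Γ w k = cong (λ t → if t then nothing else Γ (swapℕ a b w) k) (sym (sameVar-swapʳ a b w k y n))

swapₑ-fresh : ∀ a b Γ → (∀ m → Γ a m ≡ nothing) → (∀ m → Γ b m ≡ nothing) → swapₑ a b Γ ≐ Γ
swapₑ-fresh a b Γ na nb y m with y ≡ᵇ a | ≡ᵇ-view y a
... | true  | ≡ᵇ-yes refl = trans (nb m) (sym (na m))
... | false | ≡ᵇ-no p with y ≡ᵇ b | ≡ᵇ-view y b
...   | true  | ≡ᵇ-yes refl = trans (na m) (sym (nb m))
...   | false | ≡ᵇ-no q    = refl

⋄-sym : ∀ {X Y} → X ⋄ₑ Y → Y ⋄ₑ X
⋄-sym d x m n U V h₁ h₂ = sym (d x n m V U h₂ h₁)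

⋄-meetˡ : ∀ {X₁ X₂ Y} → X₁ ⋄ₑ Y → X₂ ⋄ₑ Y → (X₁ ⊓ₑ X₂) ⋄ₑ Y
⋄-meetˡ {X₁} {X₂} d₁ d₂ x m n U V h₁ h₂ with meet-just (X₁ x m) (X₂ x m) h₁
... | inj₁ (U₁ , e1) = d₁ x m n U₁ V e1 h₂
... | inj₂ (U₂ , e2) = d₂ x m n U₂ V e2 h₂

⋄-meetʳ : ∀ {X Y₁ Y₂} → X ⋄ₑ Y₁ → X ⋄ₑ Y₂ → X ⋄ₑ (Y₁ ⊓ₑ Y₂)
⋄-meetʳ d₁ d₂ = ⋄-sym (⋄-meetˡ (⋄-sym d₁) (⋄-sym d₂))

Sub⊆ : Env → Env → Set
Sub⊆ X X' = ∀ x m {U} → X x m ≡ just U → Σ UU λ U' → X' x m ≡ just U'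

⋄-mono : ∀ {X X' Y Y'} → Sub⊆ X X' → Sub⊆ Y Y' → X' ⋄ₑ Y' → X ⋄ₑ Y
⋄-mono s t d x m n U V h₁ h₂ = let U' , h₁' = s x m h₁ ; V' , h₂' = t x n h₂ in d x m n U' V' h₁' h₂'

⊆-refl : ∀ {X} → Sub⊆ X X
⊆-refl x m {U} h = U , h

⊆-rem : ∀ y n X → Sub⊆ (rem y n X) X
⊆-rem y n X x m h = _ , proj₂ (rem-just y n X x m h)

⊆-meetˡ : ∀ X Y → Sub⊆ X (X ⊓ₑ Y)
⊆-meetˡ X Y x m h = meet-l (X x m) (Y x m) h

⊆-meetʳ : ∀ X Y → Sub⊆ Y (X ⊓ₑ Y)
⊆-meetʳ X Y x m h = meet-r (X x m) (Y x m) h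

⊆-⊑' : ∀ {X Y} → X ⊑ₑ Y → Sub⊆ Y X
⊆-⊑' {X} p x m h = let W , e , _ = ⊑M-just' (subst (⊑M (X x m)) h (p x m)) in W , e

rem-⊆ : ∀ y n {X Y} → Sub⊆ X Y → Sub⊆ (rem y n X) (rem y n Y)
rem-⊆ y n {X} {Y} s w m h =
  let ne , h' = rem-just y n X w m h ; U' , h'' = s w m h' in U' , trans (rem-other y n Y w m ne) h''

weaken-env : ∀ {M Γ Γ' U} → M ∶⟨ Γ ⊢₂ U ⟩ → Γ' ⊑ₑ Γ → M ∶⟨ Γ' ⊢₂ U ⟩
weaken-env D p = sub D (⊑-refl ≈U-refl , p)

weaken-type : ∀ {M Γ U U'} → M ∶⟨ Γ ⊢₂ U ⟩ → U ⊑ U' → M ∶⟨ Γ ⊢₂ U' ⟩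
weaken-type D p = sub D (p , ⊑ₑ-refl)

retype-≐ : ∀ {M Γ Γ' U} → M ∶⟨ Γ ⊢₂ U ⟩ → Γ ≐ Γ' → M ∶⟨ Γ' ⊢₂ U ⟩
retype-≐ D e = weaken-env D (≐⇒⊑ (≐-sym e))

retype-≈ : ∀ {M Γ Γ' U} → M ∶⟨ Γ ⊢₂ U ⟩ → Γ ≈ₑ Γ' → M ∶⟨ Γ' ⊢₂ U ⟩
retype-≈ D p = weaken-env D (≈ₑ⇒⊑ₑ (≈ₑ-sym p))

GoodEnv : Env → Set
GoodEnv Γ = ∀ x n {W} → Γ x n ≡ just W → GoodU W × degU W ≡ n

GoodEnv-⊓ : ∀ {Γ₁ Γ₂} → GoodEnv Γ₁ → GoodEnv Γ₂ → GoodEnv (Γ₁ ⊓ₑ Γ₂)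
GoodEnv-⊓ {Γ₁} {Γ₂} g₁ g₂ y m h with Γ₁ y m in e1 | Γ₂ y m in e2
GoodEnv-⊓ g₁ g₂ y m refl | just _  | nothing = g₁ y m e1
GoodEnv-⊓ g₁ g₂ y m refl | nothing | just _  = g₂ y m e2
GoodEnv-⊓ g₁ g₂ y m refl | just _  | just _  =
  let a₁ , d₁ = g₁ y m e1 ; a₂ , d₂ = g₂ y m e2 in
  good-∩ a₁ a₂ (trans d₁ (sym d₂)) , trans (cong₂ _⊓_ d₁ d₂) (⊓-idem m)

GoodEnv-ex : ∀ {Γ} e → GoodEnv Γ → GoodEnv (exₑ e Γ)
GoodEnv-ex {Γ} e g y (suc m) h with Γ y m in e1
GoodEnv-ex e g y (suc m) refl | just W = let a , d = g y m e1 in good-ex a , cong suc d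

GoodEnv-⊒ : ∀ {Γ Γ'} → Γ' ⊑ₑ Γ → GoodEnv Γ → GoodEnv Γ'
GoodEnv-⊒ {Γ} q g y m h =
  let W' , h' , r = ⊑M-just (subst (λ z → ⊑M z (Γ y m)) h (q y m)) ; a , d = g y m h' in
  good-⊒ r a , trans (degU-⊑ r) d

meet-dom : ∀ {Γ₁ Γ₂} {P : ℕ → ℕ → Set} →
  (∀ x n {W} → Γ₁ x n ≡ just W → P x n) → (∀ x n {W} → Γ₂ x n ≡ just W → P x n) →
  ∀ x n {W} → (Γ₁ ⊓ₑ Γ₂) x n ≡ just W → P x n
meet-dom {Γ₁} {Γ₂} f g x n h with meet-just (Γ₁ x n) (Γ₂ x n) h
... | inj₁ (_ , e) = f x n e
... | inj₂ (_ , e) = g x n e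

deg-close : ∀ k x n M → deg (close′ k x n M) ≡ deg M
deg-close k x n (fv y m) with sameVar y m x n | sameVar-view y m x n
... | true  | same refl refl = refl
... | false | _              = refl
deg-close k x n (bv j m)  = refl
deg-close k x n (lam m M) = deg-close (suc k) x n M
deg-close k x n (app M N) = cong₂ _⊓_ (deg-close k x n M) (deg-close k x n N)

record TypingFacts (M : Tm) (Γ : Env) (U : UU) : Set where
  field
    term      : Term M
    dom⇒FV    : ∀ x n {W} → Γ x n ≡ just W → (x , n) ∈FV M
    FV⇒dom    : ∀ x n → (x , n) ∈FV M → Σ UU λ W → Γ x n ≡ just W
    env-good  : GoodEnv Γ
    type-good : GoodU U × degU U ≡ deg M
open TypingFacts public

typing-facts : ∀ {M Γ U} → M ∶⟨ Γ ⊢₂ U ⟩ → TypingFacts M Γ U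
typing-facts (ax {x} {T} g) = record
  { term      = term-var x 0
  ; dom⇒FV    = λ y m e → case-ext {y} {m} e λ { refl refl _ → fv-here }
  ; FV⇒dom    = λ { .x .0 fv-here → ⌜ T ⌝ , ext-at ∅ x 0 ⌜ T ⌝ }
  ; env-good  = λ y m e → case-ext {y} {m} e λ { refl refl refl → good-⌜⌝ g , degT≡0 T }
  ; type-good = good-⌜⌝ g , degT≡0 T }
  where
  case-ext : ∀ {y m W} {P : Set} → (∅ ,[ x , 0 ]∶ ⌜ T ⌝) y m ≡ just W →
    (y ≡ x → m ≡ 0 → W ≡ ⌜ T ⌝ → P) → P
  case-ext {y} {m} e k with ext-inv ∅ x 0 ⌜ T ⌝ y m e
  ... | inj₁ (p , q , r) = k p q r
  ... | inj₂ (_ , ())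
typing-facts (→I {M} {Γ} {x} {n} {U} {T} D e i) = record
  { term      = term-lam (term I) i
  ; dom⇒FV    = λ y m h → let ne = bound-distinct y m h in
      fv-lam (FV-close⇐ 0 x n M (dom⇒FV I y m (trans (ext-other Γ x n U y m ne) h)) ne)
  ; FV⇒dom    = λ { y m (fv-lam k) → let a , b = FV-close⇒ 0 x n M k ; W , h = FV⇒dom I y m a in
      W , trans (sym (ext-other Γ x n U y m b)) h }
  ; env-good  = λ y m h → env-good I y m (trans (ext-other Γ x n U y m (bound-distinct y m h)) h)
  ; type-good = good-⌜⌝ (good-⇒′ (proj₁ (env-good I x n (ext-at Γ x n U))) (good-body (proj₁ (type-good I)))) ,
      trans (degT≡0 (U ⇒ T)) (sym (trans (deg-close 0 x n M) (trans (sym (proj₂ (type-good I))) (degT≡0 T)))) }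
  where
  I : TypingFacts M (Γ ,[ x , n ]∶ U) ⌜ T ⌝
  I = typing-facts D
  bound-distinct : ∀ y m {W} → Γ y m ≡ just W → ¬ (y ≡ x × m ≡ n)
  bound-distinct y m h (refl , refl) with trans (sym e) h
  ... | ()
  good-body : GoodU ⌜ T ⌝ → GoodT T
  good-body (good-⌜⌝ g) = g
typing-facts (→E {M₁} {M₂} {Γ₁} {Γ₂} {U} {T} D₁ D₂ d j) = record
  { term      = term-app (term I₁) (term I₂) j
  ; dom⇒FV    = meet-dom (λ y m h → fv-appˡ (dom⇒FV I₁ y m h)) (λ y m h → fv-appʳ (dom⇒FV I₂ y m h))
  ; FV⇒dom    = λ { y m (fv-appˡ k) → let W , h = FV⇒dom I₁ y m k in meet-l (Γ₁ y m) (Γ₂ y m) h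
                  ; y m (fv-appʳ k) → let W , h = FV⇒dom I₂ y m k in meet-r (Γ₁ y m) (Γ₂ y m) h }
  ; env-good  = GoodEnv-⊓ (env-good I₁) (env-good I₂)
  ; type-good = good-⌜⌝ (good-result (proj₁ (type-good I₁))) ,
      sym (trans (cong (_⊓ deg M₂) (trans (sym (proj₂ (type-good I₁))) (degT≡0 (U ⇒ T)))) (sym (degT≡0 T))) }
  where
  I₁ : TypingFacts M₁ Γ₁ ⌜ U ⇒ T ⌝
  I₁ = typing-facts D₁
  I₂ : TypingFacts M₂ Γ₂ U
  I₂ = typing-facts D₂
  good-result : GoodU ⌜ U ⇒ T ⌝ → GoodT T
  good-result (good-⌜⌝ (good-⇒ _ g _)) = g
typing-facts (∩I {M} {Γ₁} {Γ₂} {U₁} {U₂} D₁ D₂) = record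
  { term      = term I₁
  ; dom⇒FV    = meet-dom (dom⇒FV I₁) (dom⇒FV I₂)
  ; FV⇒dom    = λ y m k → let W , h = FV⇒dom I₁ y m k in meet-l (Γ₁ y m) (Γ₂ y m) h
  ; env-good  = GoodEnv-⊓ (env-good I₁) (env-good I₂)
  ; type-good = good-∩ (proj₁ (type-good I₁)) (proj₁ (type-good I₂)) (trans (proj₂ (type-good I₁)) (sym (proj₂ (type-good I₂)))) ,
      trans (cong₂ _⊓_ (proj₂ (type-good I₁)) (proj₂ (type-good I₂))) (⊓-idem (deg M)) }
  where
  I₁ : TypingFacts M Γ₁ U₁
  I₁ = typing-facts D₁
  I₂ : TypingFacts M Γ₂ U₂
  I₂ = typing-facts D₂
typing-facts (exp {M} {Γ} {U} {e} D) = record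
  { term      = Term⁺ (term I)
  ; dom⇒FV    = dom⇒FV⁺
  ; FV⇒dom    = FV⁺⇒dom
  ; env-good  = GoodEnv-ex e (env-good I)
  ; type-good = good-ex (proj₁ (type-good I)) , trans (cong suc (proj₂ (type-good I))) (sym (deg⁺ M)) }
  where
  I : TypingFacts M Γ U
  I = typing-facts D
  dom⇒FV⁺ : ∀ y m {W} → exₑ e Γ y m ≡ just W → (y , m) ∈FV (M ⁺)
  dom⇒FV⁺ y (suc m) h with Γ y m in e1
  dom⇒FV⁺ y (suc m) refl | just W = FV-⁺⇒ M (dom⇒FV I y m e1)
  FV⁺⇒dom : ∀ y m → (y , m) ∈FV (M ⁺) → Σ UU λ W → exₑ e Γ y m ≡ just W
  FV⁺⇒dom y m k with FV-⁺⇐ M k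
  ... | m₀ , refl , k' with FV⇒dom I y m₀ k'
  ... | W , h rewrite h = ex e W , refl
typing-facts (sub {M} {Γ} {U} {Γ'} {U'} D (p , q)) = record
  { term      = term I
  ; dom⇒FV    = λ y m h → let W' , h' , _ = ⊑M-just (subst (λ z → ⊑M z (Γ y m)) h (q y m)) in dom⇒FV I y m h'
  ; FV⇒dom    = λ y m k → let W , h = FV⇒dom I y m k ; W' , h' , _ = ⊑M-just' (subst (⊑M (Γ' y m)) h (q y m)) in W' , h'
  ; env-good  = GoodEnv-⊒ q (env-good I)
  ; type-good = good-⊑ p (proj₁ (type-good I)) , trans (sym (degU-⊑ p)) (proj₂ (type-good I)) }
  where
  I : TypingFacts M Γ U
  I = typing-facts D

⋄⇒Joinable : ∀ {M₁ M₂ Γ₁ Γ₂ U₁ U₂} → M₁ ∶⟨ Γ₁ ⊢₂ U₁ ⟩ → M₂ ∶⟨ Γ₂ ⊢₂ U₂ ⟩ → Γ₁ ⋄ₑ Γ₂ → Joinable M₁ M₂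
⋄⇒Joinable D₁ D₂ d x m n i j =
  let W₁ , h₁ = FV⇒dom (typing-facts D₁) x m i ; W₂ , h₂ = FV⇒dom (typing-facts D₂) x n j in d x m n W₁ W₂ h₁ h₂

Joinable⇒⋄ : ∀ {M₁ M₂ Γ₁ Γ₂ U₁ U₂} → M₁ ∶⟨ Γ₁ ⊢₂ U₁ ⟩ → M₂ ∶⟨ Γ₂ ⊢₂ U₂ ⟩ → Joinable M₁ M₂ → Γ₁ ⋄ₑ Γ₂
Joinable⇒⋄ D₁ D₂ j x m n U V h₁ h₂ = j x m n (dom⇒FV (typing-facts D₁) x m h₁) (dom⇒FV (typing-facts D₂) x n h₂)

outside-dom : ∀ {M Γ U} → M ∶⟨ Γ ⊢₂ U ⟩ → ∀ {a m} → ¬ (a , m) ∈FV M → Γ a m ≡ nothing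
outside-dom {Γ = Γ} D {a} {m} na with Γ a m in e
... | nothing = refl
... | just _  = ⊥-elim (na (dom⇒FV (typing-facts D) a m e))

fresh-outside-dom : ∀ {M Γ U} → M ∶⟨ Γ ⊢₂ U ⟩ → ∀ {a} → NoName a M → ∀ m → Γ a m ≡ nothing
fresh-outside-dom D na m = outside-dom D (na m)

dom-fresh-≢ : ∀ {Γ : Env} {y n a W} → Γ y n ≡ just W → (∀ m → Γ a m ≡ nothing) → ¬ y ≡ a
dom-fresh-≢ h na refl with trans (sym h) (na _)
... | ()

rename-typing : ∀ a b {M Γ U} → M ∶⟨ Γ ⊢₂ U ⟩ → swap a b M ∶⟨ swapₑ a b Γ ⊢₂ U ⟩
rename-typing a b (ax {x} {T} g) = retype-≐ (ax g) (≐-sym (swapₑ-ext a b ∅ x 0 ⌜ T ⌝))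
rename-typing a b (→I {M} {Γ} {x} {n} {U} {T} D e i) rewrite swap-close a b 0 x n M =
  →I (retype-≐ (rename-typing a b D) (swapₑ-ext a b Γ x n U)) (trans (cong (λ z → Γ z n) (swapℕ-invol a b x)) e)
     (FV-swap a b M i)
rename-typing a b (→E {M₁} {M₂} D₁ D₂ d j) =
  →E (rename-typing a b D₁) (rename-typing a b D₂) (λ x m n U V h₁ h₂ → d (swapℕ a b x) m n U V h₁ h₂)
     (Joinable-swap a b M₁ M₂ j)
rename-typing a b (∩I D₁ D₂) = ∩I (rename-typing a b D₁) (rename-typing a b D₂)
rename-typing a b (exp {M} {Γ} {U} {e} D) rewrite swap-⁺ a b M =
  retype-≐ (exp (rename-typing a b D)) (≐-sym (swapₑ-ex a b e Γ))
rename-typing a b (sub D (p , q)) = sub (rename-typing a b D) (p , λ y m → q (swapℕ a b y) m)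

-- Two derivations of the same term have the same domain, so the meet of their
-- environments is below each of them.
env-∩ˡ : ∀ {M Γ₁ Γ₂ U₁ U₂} → M ∶⟨ Γ₁ ⊢₂ U₁ ⟩ → M ∶⟨ Γ₂ ⊢₂ U₂ ⟩ → (Γ₁ ⊓ₑ Γ₂) ⊑ₑ Γ₁
env-∩ˡ {M} {Γ₁} {Γ₂} D₁ D₂ y m with Γ₁ y m in e1 | Γ₂ y m in e2
... | just U  | just V  = let g1 , d1 = env-good (typing-facts D₁) y m e1 ; g2 , d2 = env-good (typing-facts D₂) y m e2 in
      just (⊑-∩ˡ g2 (trans d1 (sym d2)))
... | just U  | nothing = just (⊑-refl ≈U-refl)
... | nothing | nothing = nothing
... | nothing | just V with trans (sym e1) (proj₂ (FV⇒dom (typing-facts D₁) y m (dom⇒FV (typing-facts D₂) y m e2)))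
...   | ()

env-∩ʳ : ∀ {M Γ₁ Γ₂ U₁ U₂} → M ∶⟨ Γ₁ ⊢₂ U₁ ⟩ → M ∶⟨ Γ₂ ⊢₂ U₂ ⟩ → (Γ₁ ⊓ₑ Γ₂) ⊑ₑ Γ₂
env-∩ʳ {M} {Γ₁} {Γ₂} D₁ D₂ = ⊑ₑ-trans (≈ₑ⇒⊑ₑ (λ y m → meet-comm (Γ₁ y m) (Γ₂ y m))) (env-∩ˡ D₂ D₁)

-- The
-- rules ∩I and exp just select a component and ⊑ only weakens it (Covers).

_+^_ : Tm → ℕ → Tm
M +^ zero  = M
M +^ suc k = (M +^ k) ⁺

generation : ∀ {M Γ V} → M ∶⟨ Γ ⊢₂ V ⟩ → ∀ {p T} → (p , T) ∈ comps V →
  Σ Tm λ M' → Σ Env λ Γ' → M ≡ M' +^ length p × M' ∶⟨ Γ' ⊢₂ ⌜ T ⌝ ⟩ × Γ ⊑ₑ exsₑ p Γ'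
generation D@(ax g) (here refl) = _ , _ , refl , D , ⊑ₑ-refl
generation D@(→I _ _ _) (here refl) = _ , _ , refl , D , ⊑ₑ-refl
generation D@(→E _ _ _ _) (here refl) = _ , _ , refl , D , ⊑ₑ-refl
generation (∩I {U₁ = U₁} D₁ D₂) i with ∈-++⁻ (comps U₁) i
... | inj₁ j = let M' , Γ' , a , b , c = generation D₁ j in M' , Γ' , a , b , ⊑ₑ-trans (env-∩ˡ D₁ D₂) c
... | inj₂ j = let M' , Γ' , a , b , c = generation D₂ j in M' , Γ' , a , b , ⊑ₑ-trans (env-∩ʳ D₁ D₂) c
generation (exp {e = e} D) i with ∈-map⁻ (pre e) i
... | (p₀ , T₀) , j , refl = let M' , Γ' , a , b , c = generation D j in M' , Γ' , cong _⁺ a , b , ⊑ₑ-ex e c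
generation (sub D (q , r)) {p} {T} i with covering (⊑⇒Covers q) i
... | (p₀ , T₀) , j , refl , le = let M' , Γ' , a , b , c = generation D j in
      M' , Γ' , a , weaken-type b (≤T⇒⊑ T₀ T le) , ⊑ₑ-trans r c

generation-λ : ∀ {M Γ V} → M ∶⟨ Γ ⊢₂ V ⟩ → ∀ {n B} → M ≡ lam n B → ∀ {U T} → ([] , U ⇒ T) ∈ comps V →
  Σ ℕ λ x → Σ Tm λ P → Σ UU λ U' → Σ TT λ T' → Σ Env λ Γ' →
    B ≡ close x n P × P ∶⟨ Γ' ,[ x , n ]∶ U' ⊢₂ ⌜ T' ⌝ ⟩ × Γ' x n ≡ nothing × (x , n) ∈FV P ×
    U ⊑ U' × ⌜ T' ⌝ ⊑ ⌜ T ⌝ × Γ ⊑ₑ Γ'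
generation-λ (ax g) () i
generation-λ (→E _ _ _ _) () i
generation-λ (→I {M} {Γ} {x} {n} {U} {T} D e k) refl (here refl) =
  x , M , U , T , Γ , refl , D , e , k , ⊑-refl ≈U-refl , ⊑-refl ≈U-refl , ⊑ₑ-refl
generation-λ (→I D e k) refl (there ())
generation-λ (∩I {U₁ = U₁} D₁ D₂) eq i with ∈-++⁻ (comps U₁) i
... | inj₁ j = let x , P , U' , T' , Γ' , a , b , c , d , f , g , h = generation-λ D₁ eq j in
      x , P , U' , T' , Γ' , a , b , c , d , f , g , ⊑ₑ-trans (env-∩ˡ D₁ D₂) h
... | inj₂ j = let x , P , U' , T' , Γ' , a , b , c , d , f , g , h = generation-λ D₂ eq j in
      x , P , U' , T' , Γ' , a , b , c , d , f , g , ⊑ₑ-trans (env-∩ʳ D₁ D₂) h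
generation-λ (exp {U = U} {e = e} D) eq i = ⊥-elim (comps-ex-prefixed e U i)
generation-λ (sub D (q , r)) eq {U} {T} i with covering (⊑⇒Covers q) i
... | ([] , (U₁ ⇒ T₁)) , j , refl , (s , t) =
      let x , P , U' , T' , Γ' , a , b , c , d , f , g , h = generation-λ D eq j in
      x , P , U' , T' , Γ' , a , b , c , d , ⊑-trans s f , ⊑-trans g t , ⊑ₑ-trans r h
... | ([] , atom _) , j , refl , ()

comps-nonempty : ∀ W → Σ Comp λ c → c ∈ comps W
comps-nonempty (U ∩ V) = let c , i = comps-nonempty U in c , ∈-++⁺ˡ i
comps-nonempty (ex e U) = let c , i = comps-nonempty U in pre e c , ∈-map⁺ (pre e) i
comps-nonempty ⌜ T ⌝ = _ , here refl

ComponentsTyped : List ℕ → Tm → Env → UU → Set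
ComponentsTyped q A₀ Δ W = ∀ {p T} → (p , T) ∈ comps W →
  Σ Tm λ A' → Σ Env λ Γ' → A₀ ≡ A' +^ length p × A' ∶⟨ Γ' ⊢₂ ⌜ T ⌝ ⟩ × Δ ⊑ₑ exsₑ q (exsₑ p Γ')

reassemble : ∀ W q A₀ Δ → ComponentsTyped q A₀ Δ W → Σ Env λ Δ₀ → A₀ ∶⟨ Δ₀ ⊢₂ W ⟩ × Δ ⊑ₑ exsₑ q Δ₀
reassemble ⌜ T ⌝ q A₀ Δ h with h (here refl)
... | A' , Γ' , refl , D , le = Γ' , D , le
reassemble (W₁ ∩ W₂) q A₀ Δ h =
  let Δ₁ , D₁ , le₁ = reassemble W₁ q A₀ Δ (λ i → h (∈-++⁺ˡ i))
      Δ₂ , D₂ , le₂ = reassemble W₂ q A₀ Δ (λ i → h (∈-++⁺ʳ (comps W₁) i))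
  in Δ₁ ⊓ₑ Δ₂ , ∩I D₁ D₂ , ⊑ₑ-trans (⊑ₑ-glb le₁ le₂) (exs-⊓ q Δ₁ Δ₂)
reassemble (ex f W) q A₀ Δ h with comps-nonempty W
... | (p , T) , i with h (∈-map⁺ (pre f) i)
... | A' , Γ' , refl , _ , _ =
  let Δ₀ , D , le = reassemble W (q ++ f ∷ []) (A' +^ length p) Δ h'
  in exₑ f Δ₀ , exp D , ⊑ₑ-≐ le (exs-snoc q f Δ₀)
  where
  h' : ComponentsTyped (q ++ f ∷ []) (A' +^ length p) Δ W
  h' {p'} {T'} j with h (∈-map⁺ (pre f) j)
  ... | A'' , Γ'' , eq , D'' , le = A'' , Γ'' , ⁺-inj _ _ eq , D'' , ⊑ₑ-≐ le (≐-sym (exs-snoc q f (exsₑ p' Γ'')))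

unexpand : ∀ {A Δ e W} → A ∶⟨ Δ ⊢₂ ex e W ⟩ →
  Σ Tm λ A₀ → Σ Env λ Δ₀ → A ≡ A₀ ⁺ × A₀ ∶⟨ Δ₀ ⊢₂ W ⟩ × Δ ⊑ₑ exₑ e Δ₀
unexpand {A} {Δ} {e} {W} D with comps-nonempty W
... | (p , T) , i with generation D (∈-map⁺ (pre e) i)
... | A' , Γ' , refl , _ , _ =
  let Δ₀ , D₀ , le = reassemble W (e ∷ []) (A' +^ length p) Δ h in
  A' +^ length p , Δ₀ , refl , D₀ , le
  where
  h : ComponentsTyped (e ∷ []) (A' +^ length p) Δ W
  h {p'} {T'} j with generation D (∈-map⁺ (pre e) j)
  ... | A'' , Γ'' , eq , D'' , le = A'' , Γ'' , ⁺-inj _ _ eq , D'' , le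

declared-distinct : ∀ {Γ : Env} {y n w m U} → Γ y n ≡ nothing → Γ w m ≡ just U → ¬ (w ≡ y × m ≡ n)
declared-distinct e h (refl , refl) with trans (sym e) h
... | ()

undeclared-∉FV : ∀ {M Γ U y n} → M ∶⟨ Γ ⊢₂ U ⟩ → Γ y n ≡ nothing → ¬ (y , n) ∈FV M
undeclared-∉FV D e k with trans (sym e) (proj₂ (FV⇒dom (typing-facts D) _ _ k))
... | ()

⊆-rem-meetˡ : ∀ y n Γ₁ Γ₂ → Γ₁ y n ≡ nothing → Sub⊆ Γ₁ (rem y n (Γ₁ ⊓ₑ Γ₂))
⊆-rem-meetˡ y n Γ₁ Γ₂ e w m h =
  let V , hv = ⊆-meetˡ Γ₁ Γ₂ w m h in V , trans (rem-other y n (Γ₁ ⊓ₑ Γ₂) w m (declared-distinct e h)) hv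

⊆-rem-meetʳ : ∀ y n Γ₁ Γ₂ → Γ₂ y n ≡ nothing → Sub⊆ Γ₂ (rem y n (Γ₁ ⊓ₑ Γ₂))
⊆-rem-meetʳ y n Γ₁ Γ₂ e w m h =
  let V , hv = ⊆-meetʳ Γ₁ Γ₂ w m h in V , trans (rem-other y n (Γ₁ ⊓ₑ Γ₂) w m (declared-distinct e h)) hv

rem-meet-left : ∀ y n Γ₁ Γ₂ Δ → Γ₂ y n ≡ nothing →
  ((rem y n Γ₁ ⊓ₑ Δ) ⊓ₑ Γ₂) ≈ₑ (rem y n (Γ₁ ⊓ₑ Γ₂) ⊓ₑ Δ)
rem-meet-left y n Γ₁ Γ₂ Δ e w m =
  ≈M-trans (meet-swap (rem y n Γ₁ w m) (Γ₂ w m) (Δ w m))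
    (meet-cong (≡⇒≈M (sym (trans (rem-⊓ y n Γ₁ Γ₂ w m) (cong (meetM (rem y n Γ₁ w m)) (rem-notin y n Γ₂ e w m)))))
               (≈M-refl _))

rem-meet-right : ∀ y n Γ₁ Γ₂ Δ → Γ₁ y n ≡ nothing →
  (Γ₁ ⊓ₑ (rem y n Γ₂ ⊓ₑ Δ)) ≈ₑ (rem y n (Γ₁ ⊓ₑ Γ₂) ⊓ₑ Δ)
rem-meet-right y n Γ₁ Γ₂ Δ e w m =
  ≈M-trans (≈M-sym (meet-assoc (Γ₁ w m) (rem y n Γ₂ w m) (Δ w m)))
    (meet-cong (≡⇒≈M (sym (trans (rem-⊓ y n Γ₁ Γ₂ w m) (cong (λ t → meetM t (rem y n Γ₂ w m)) (rem-notin y n Γ₁ e w m)))))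
               (≈M-refl _))

rem-meet-interchange : ∀ y n Θ₁ Θ₂ Δ₁ Δ₂ →
  ((rem y n Θ₁ ⊓ₑ Δ₁) ⊓ₑ (rem y n Θ₂ ⊓ₑ Δ₂)) ≈ₑ (rem y n (Θ₁ ⊓ₑ Θ₂) ⊓ₑ (Δ₁ ⊓ₑ Δ₂))
rem-meet-interchange y n Θ₁ Θ₂ Δ₁ Δ₂ w m =
  ≈M-trans (meet-interchange (rem y n Θ₁ w m) (rem y n Θ₂ w m) (Δ₁ w m) (Δ₂ w m))
    (meet-cong (≡⇒≈M (sym (rem-⊓ y n Θ₁ Θ₂ w m))) (≈M-refl _))

rem-meet-distrib : ∀ y n Θ₁ Θ₂ Δ →
  ((rem y n Θ₁ ⊓ₑ Δ) ⊓ₑ (rem y n Θ₂ ⊓ₑ Δ)) ≈ₑ (rem y n (Θ₁ ⊓ₑ Θ₂) ⊓ₑ Δ)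
rem-meet-distrib y n Θ₁ Θ₂ Δ w m =
  ≈M-trans (rem-meet-interchange y n Θ₁ Θ₂ Δ Δ w m) (meet-cong (≈M-refl _) (meet-idem (Δ w m)))

⋄-ex⁻¹ : ∀ {e X Δ Δ₀} → exₑ e X ⋄ₑ Δ → Δ ⊑ₑ exₑ e Δ₀ → X ⋄ₑ Δ₀
⋄-ex⁻¹ {e} d le w m m' U₁ V₁ h₁ h₂ =
  let V' , hv = ⊆-⊑' le w (suc m') (cong (Maybe.map (ex e)) h₂)
  in suc-injective (d w (suc m) (suc m') _ _ (cong (Maybe.map (ex e)) h₁) hv)

∩-split : ∀ {A Δ W₁ W₂ n} → GoodU W₁ × degU W₁ ≡ n → GoodU W₂ × degU W₂ ≡ n →
  A ∶⟨ Δ ⊢₂ W₁ ∩ W₂ ⟩ → A ∶⟨ Δ ⊢₂ W₁ ⟩ × A ∶⟨ Δ ⊢₂ W₂ ⟩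
∩-split (g₁ , d₁) (g₂ , d₂) D =
  weaken-type D (⊑-∩ˡ g₂ (trans d₁ (sym d₂))) ,
  weaken-type D (⊑-trans (⊑-refl ∩-comm) (⊑-∩ˡ g₁ (trans d₂ (sym d₁))))

⋄-rem-ext-swap : ∀ {Γ Δ} y n x n₁ U z → (∀ m → Γ z m ≡ nothing) → (∀ m → Δ z m ≡ nothing) →
  rem y n Γ ⋄ₑ Δ → rem y n (Γ ,[ x , n₁ ]∶ U) ⋄ₑ swapₑ x z Δ
⋄-rem-ext-swap {Γ} {Δ} y n x n₁ U z Γ-z Δ-z d w m m' U₁ V₁ h₁ h₂ with w ≟ x
... | yes refl with trans (sym h₂) (trans (cong (λ t → Δ t m') (swapℕ-left x z)) (Δ-z m'))
...   | ()
⋄-rem-ext-swap {Γ} {Δ} y n x n₁ U z Γ-z Δ-z d w m m' U₁ V₁ h₁ h₂ | no w≢x with w ≟ z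
...   | yes refl with trans (sym h₁) (trans (rem-ext y n Γ x n₁ U z m (λ q → w≢x (proj₁ q))) (rem-nothing y n Γ z m (Γ-z m)))
...     | ()
⋄-rem-ext-swap {Γ} {Δ} y n x n₁ U z Γ-z Δ-z d w m m' U₁ V₁ h₁ h₂ | no w≢x | no w≢z =
  d w m m' U₁ V₁ (trans (sym (rem-ext y n Γ x n₁ U w m (λ q → w≢x (proj₁ q)))) h₁)
                 (trans (cong (λ t → Δ t m') (sym (swapℕ-other x z w w≢x w≢z))) h₂)

rem-ext-meet : ∀ {y n x n₁} Γ Δ U → ¬ y ≡ x → Δ x n₁ ≡ nothing →
  (rem y n (Γ ,[ x , n₁ ]∶ U) ⊓ₑ Δ) ≐ ((rem y n Γ ⊓ₑ Δ) ,[ x , n₁ ]∶ U)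
rem-ext-meet {y} {n} {x} {n₁} Γ Δ U y≢x Δx w m with var? w m x n₁
... | yes (refl , refl) =
  trans (cong₂ meetM (trans (rem-other y n (Γ ,[ x , n₁ ]∶ U) x n₁ (λ q → y≢x (sym (proj₁ q)))) (ext-at Γ x n₁ U)) Δx)
        (sym (ext-at (rem y n Γ ⊓ₑ Δ) x n₁ U))
... | no ne = trans (cong (λ t → meetM t (Δ w m)) (rem-ext y n Γ x n₁ U w m ne))
                    (sym (ext-other (rem y n Γ ⊓ₑ Δ) x n₁ U w m ne))

swapₑ-meet-back : ∀ a b X Δ → (∀ m → X a m ≡ nothing) → (∀ m → X b m ≡ nothing) →
  swapₑ a b (X ⊓ₑ swapₑ a b Δ) ≐ (X ⊓ₑ Δ)
swapₑ-meet-back a b X Δ Xa Xb w m =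
  cong₂ meetM (swapₑ-fresh a b X Xa Xb w m) (cong (λ t → Δ t m) (swapℕ-invol a b w))

substN-cong : ∀ {y₁ y₂ n A₁ A₂ P₁ P₂} → y₁ ≡ y₂ → A₁ ≡ A₂ → P₁ ≡ P₂ → substN y₁ n A₁ P₁ ≡ substN y₂ n A₂ P₂
substN-cong refl refl refl = refl

-- Substitution under a binder: for y^n declared in Γ, (λx^n₁.M)[y^n := A]
-- is typed from a typing of M[y^n := A'] where A' renames x in A to a name
-- z fresh for M and A; since x and z are fresh for λx^n₁.M and for Γ,
-- swapping back yields the substitution of A.
substitution-λ : ∀ {M Γ x n₁ U T y n W A Δ} →
  M ∶⟨ Γ ,[ x , n₁ ]∶ U ⊢₂ ⌜ T ⌝ ⟩ → Γ x n₁ ≡ nothing → (x , n₁) ∈FV M →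
  (∀ {A' Δ'} → (Γ ,[ x , n₁ ]∶ U) y n ≡ just W → A' ∶⟨ Δ' ⊢₂ W ⟩ → rem y n (Γ ,[ x , n₁ ]∶ U) ⋄ₑ Δ' →
     substN y n A' M ∶⟨ rem y n (Γ ,[ x , n₁ ]∶ U) ⊓ₑ Δ' ⊢₂ ⌜ T ⌝ ⟩) →
  Γ y n ≡ just W → A ∶⟨ Δ ⊢₂ W ⟩ → rem y n Γ ⋄ₑ Δ →
  substN y n A (lam n₁ (close x n₁ M)) ∶⟨ rem y n Γ ⊓ₑ Δ ⊢₂ ⌜ U ⇒ T ⌝ ⟩
substitution-λ {M} {Γ} {x} {n₁} {U} {T} {y} {n} {W} {A} {Δ} D e i IH h DA d =
  subst (λ t → t ∶⟨ rem y n Γ ⊓ₑ Δ ⊢₂ ⌜ U ⇒ T ⌝ ⟩) swap-back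
        (retype-≐ (rename-typing x z D-renamed) (swapₑ-meet-back x z (rem y n Γ) Δ (rem-fresh x∉P) (rem-fresh z∉P)))
  where
  P : Tm
  P = lam n₁ (close x n₁ M)
  z : ℕ
  z = suc (maxFV M ⊔ maxFV A)
  z∉A : NoName z A
  z∉A = fresh-NoName A (s≤s (m≤n⊔m _ _))
  x∉P : NoName x P
  x∉P = λ-binder-fresh (term (typing-facts D)) i
  z∉P : NoName z P
  z∉P m (fv-lam k) = fresh-NoName M (s≤s (m≤m⊔n _ _)) m (proj₁ (FV-close⇒ 0 x n₁ M k))
  rem-fresh : ∀ {a} → NoName a P → ∀ m → rem y n Γ a m ≡ nothing
  rem-fresh a∉P m = rem-nothing y n Γ _ m (fresh-outside-dom (→I D e i) a∉P m)
  y≢x : ¬ y ≡ x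
  y≢x = dom-fresh-≢ {Γ} h (fresh-outside-dom (→I D e i) x∉P)
  y≢z : ¬ y ≡ z
  y≢z = dom-fresh-≢ {Γ} h (fresh-outside-dom (→I D e i) z∉P)
  A' : Tm
  A' = swap x z A
  x∉A' : ¬ (x , n₁) ∈FV A'
  x∉A' k = z∉A n₁ (subst (λ t → (t , n₁) ∈FV A) (swapℕ-left x z) (FV-swap⁻¹ x z A k))
  Δ'-x : swapₑ x z Δ x n₁ ≡ nothing
  Δ'-x = trans (cong (λ t → Δ t n₁) (swapℕ-left x z)) (fresh-outside-dom DA z∉A n₁)
  Ξ : Env
  Ξ = rem y n Γ ⊓ₑ swapₑ x z Δ
  D-body : substN y n A' M ∶⟨ Ξ ,[ x , n₁ ]∶ U ⊢₂ ⌜ T ⌝ ⟩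
  D-body = retype-≐ (IH (trans (ext-other Γ x n₁ U y n (λ q → y≢x (proj₁ q))) h) (rename-typing x z DA)
                        (⋄-rem-ext-swap y n x n₁ U z (fresh-outside-dom (→I D e i) z∉P) (fresh-outside-dom DA z∉A) d))
                    (rem-ext-meet Γ (swapₑ x z Δ) U y≢x Δ'-x)
  D-renamed : substN y n A' P ∶⟨ Ξ ⊢₂ ⌜ U ⇒ T ⌝ ⟩
  D-renamed rewrite subst-close 0 y n A' x n₁ M y≢x x∉A' =
    →I D-body (cong₂ meetM (rem-fresh x∉P n₁) Δ'-x) (FV-subst⇐M y n A' M i (λ q → y≢x (sym (proj₁ q))))
  swap-back : swap x z (substN y n A' P) ≡ substN y n A P
  swap-back = begin
    swap x z (substN y n A' P)                            ≡⟨ swap-subst x z y n A' P ⟩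
    substN (swapℕ x z y) n (swap x z A') (swap x z P)     ≡⟨ substN-cong (swapℕ-other x z y y≢x y≢z)
                                                                         (swap-invol x z A) (swap-fresh x z P x∉P z∉P) ⟩
    substN y n A P                                        ∎
    where open ≡-Reasoning

substitution-lemma : ∀ {P Θ V} → P ∶⟨ Θ ⊢₂ V ⟩ → ∀ {y n W A Δ} → Θ y n ≡ just W → A ∶⟨ Δ ⊢₂ W ⟩ →
  rem y n Θ ⋄ₑ Δ → substN y n A P ∶⟨ rem y n Θ ⊓ₑ Δ ⊢₂ V ⟩
substitution-lemma (ax {x} {T} g) {y} {n} {W} {A} {Δ} h DA d with ext-inv ∅ x 0 ⌜ T ⌝ y n h
... | inj₂ (_ , ())
... | inj₁ (refl , refl , refl) rewrite sameVar-refl x 0 =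
  retype-≐ DA λ w m → cong (λ t → meetM t (Δ w m)) (sym (rem-ext-inverse ∅ x 0 ⌜ T ⌝ refl w m))
substitution-lemma (→I D e i) h DA d = substitution-λ D e i (λ h' → substitution-lemma D h') h DA d
substitution-lemma (→E {M₁} {M₂} {Γ₁} {Γ₂} {U} {T} D₁ D₂ dd j) {y} {n} {W} {A} {Δ} h DA d
  with Γ₁ y n in e1 | Γ₂ y n in e2
... | just W₁ | nothing with h
...   | refl = retype-≈ D' (rem-meet-left y n Γ₁ Γ₂ Δ e2)
  where
  d₁ : rem y n Γ₁ ⋄ₑ Δ
  d₁ = ⋄-mono (rem-⊆ y n (⊆-meetˡ Γ₁ Γ₂)) ⊆-refl d
  IH : substN y n A M₁ ∶⟨ rem y n Γ₁ ⊓ₑ Δ ⊢₂ ⌜ U ⇒ T ⌝ ⟩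
  IH = substitution-lemma D₁ e1 DA d₁
  dd' : (rem y n Γ₁ ⊓ₑ Δ) ⋄ₑ Γ₂
  dd' = ⋄-meetˡ (⋄-mono (⊆-rem y n Γ₁) ⊆-refl dd) (⋄-sym (⋄-mono (⊆-rem-meetʳ y n Γ₁ Γ₂ e2) ⊆-refl d))
  D' : substN y n A (app M₁ M₂) ∶⟨ (rem y n Γ₁ ⊓ₑ Δ) ⊓ₑ Γ₂ ⊢₂ ⌜ T ⌝ ⟩
  D' rewrite subst-notin y n A M₂ (undeclared-∉FV D₂ e2) = →E IH D₂ dd' (⋄⇒Joinable IH D₂ dd')
substitution-lemma (→E {M₁} {M₂} {Γ₁} {Γ₂} {U} {T} D₁ D₂ dd j) {y} {n} {W} {A} {Δ} h DA d | nothing | just W₂ with h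
...   | refl = retype-≈ D' (rem-meet-right y n Γ₁ Γ₂ Δ e1)
  where
  d₂ : rem y n Γ₂ ⋄ₑ Δ
  d₂ = ⋄-mono (rem-⊆ y n (⊆-meetʳ Γ₁ Γ₂)) ⊆-refl d
  IH : substN y n A M₂ ∶⟨ rem y n Γ₂ ⊓ₑ Δ ⊢₂ U ⟩
  IH = substitution-lemma D₂ e2 DA d₂
  dd' : Γ₁ ⋄ₑ (rem y n Γ₂ ⊓ₑ Δ)
  dd' = ⋄-meetʳ (⋄-mono ⊆-refl (⊆-rem y n Γ₂) dd) (⋄-mono (⊆-rem-meetˡ y n Γ₁ Γ₂ e1) ⊆-refl d)
  D' : substN y n A (app M₁ M₂) ∶⟨ Γ₁ ⊓ₑ (rem y n Γ₂ ⊓ₑ Δ) ⊢₂ ⌜ T ⌝ ⟩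
  D' rewrite subst-notin y n A M₁ (undeclared-∉FV D₁ e1) = →E D₁ IH dd' (⋄⇒Joinable D₁ IH dd')
substitution-lemma (→E {M₁} {M₂} {Γ₁} {Γ₂} {U} {T} D₁ D₂ dd j) {y} {n} {W} {A} {Δ} h DA d | just W₁ | just W₂ with h
...   | refl = retype-≈ (→E IH₁ IH₂ dd' (⋄⇒Joinable IH₁ IH₂ dd')) (rem-meet-distrib y n Γ₁ Γ₂ Δ)
  where
  DA₁,₂ : A ∶⟨ Δ ⊢₂ W₁ ⟩ × A ∶⟨ Δ ⊢₂ W₂ ⟩
  DA₁,₂ = ∩-split (env-good (typing-facts D₁) y n e1) (env-good (typing-facts D₂) y n e2) DA
  d₁ : rem y n Γ₁ ⋄ₑ Δ
  d₁ = ⋄-mono (rem-⊆ y n (⊆-meetˡ Γ₁ Γ₂)) ⊆-refl d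
  d₂ : rem y n Γ₂ ⋄ₑ Δ
  d₂ = ⋄-mono (rem-⊆ y n (⊆-meetʳ Γ₁ Γ₂)) ⊆-refl d
  IH₁ : substN y n A M₁ ∶⟨ rem y n Γ₁ ⊓ₑ Δ ⊢₂ ⌜ U ⇒ T ⌝ ⟩
  IH₁ = substitution-lemma D₁ e1 (proj₁ DA₁,₂) d₁
  IH₂ : substN y n A M₂ ∶⟨ rem y n Γ₂ ⊓ₑ Δ ⊢₂ U ⟩
  IH₂ = substitution-lemma D₂ e2 (proj₂ DA₁,₂) d₂
  dd' : (rem y n Γ₁ ⊓ₑ Δ) ⋄ₑ (rem y n Γ₂ ⊓ₑ Δ)
  dd' = ⋄-meetˡ (⋄-meetʳ (⋄-mono (⊆-rem y n Γ₁) (⊆-rem y n Γ₂) dd) d₁)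
                (⋄-meetʳ (⋄-sym d₂) (Joinable⇒⋄ DA DA (Term-self-joinable (term (typing-facts DA)))))
substitution-lemma (→E D₁ D₂ dd j) () DA d | nothing | nothing
substitution-lemma (∩I {M} {Γ₁} {Γ₂} {U₁} {U₂} D₁ D₂) {y} {n} {W} {A} {Δ} h DA d
  with Γ₁ y n in e1 | Γ₂ y n in e2
... | just W₁ | just W₂ with h
...   | refl = retype-≈ (∩I IH₁ IH₂) (rem-meet-distrib y n Γ₁ Γ₂ Δ)
  where
  DA₁,₂ : A ∶⟨ Δ ⊢₂ W₁ ⟩ × A ∶⟨ Δ ⊢₂ W₂ ⟩
  DA₁,₂ = ∩-split (env-good (typing-facts D₁) y n e1) (env-good (typing-facts D₂) y n e2) DA
  IH₁ : substN y n A M ∶⟨ rem y n Γ₁ ⊓ₑ Δ ⊢₂ U₁ ⟩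
  IH₁ = substitution-lemma D₁ e1 (proj₁ DA₁,₂) (⋄-mono (rem-⊆ y n (⊆-meetˡ Γ₁ Γ₂)) ⊆-refl d)
  IH₂ : substN y n A M ∶⟨ rem y n Γ₂ ⊓ₑ Δ ⊢₂ U₂ ⟩
  IH₂ = substitution-lemma D₂ e2 (proj₂ DA₁,₂) (⋄-mono (rem-⊆ y n (⊆-meetʳ Γ₁ Γ₂)) ⊆-refl d)
substitution-lemma (∩I D₁ D₂) h DA d | just W₁ | nothing
  with trans (sym e2) (proj₂ (FV⇒dom (typing-facts D₂) _ _ (dom⇒FV (typing-facts D₁) _ _ e1)))
... | ()
substitution-lemma (∩I D₁ D₂) h DA d | nothing | just W₂
  with trans (sym e1) (proj₂ (FV⇒dom (typing-facts D₁) _ _ (dom⇒FV (typing-facts D₂) _ _ e2)))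
... | ()
substitution-lemma (∩I D₁ D₂) () DA d | nothing | nothing
substitution-lemma (exp {M} {Γ} {U} {e} D) {y} {suc n₀} {W} {A} {Δ} h DA d with Γ y n₀ in e1
substitution-lemma (exp D) {y} {suc n₀} ()   DA d | nothing
substitution-lemma (exp {M} {Γ} {U} {e} D) {y} {suc n₀} {W} {A} {Δ} refl DA d | just W₀
  with unexpand DA
... | A₀ , Δ₀ , refl , DA₀ , le = weaken-env (subst (λ t → t ∶⟨ _ ⊢₂ ex e U ⟩) (subst⁺ y n₀ A₀ M) (exp IH)) env-le
  where
  IH : substN y n₀ A₀ M ∶⟨ rem y n₀ Γ ⊓ₑ Δ₀ ⊢₂ U ⟩
  IH = substitution-lemma D e1 DA₀ (⋄-ex⁻¹ (⋄-mono (λ w m h → _ , trans (rem-ex y n₀ e Γ w m) h) ⊆-refl d) le)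
  env-le : (rem y (suc n₀) (exₑ e Γ) ⊓ₑ Δ) ⊑ₑ exₑ e (rem y n₀ Γ ⊓ₑ Δ₀)
  env-le = ⊑ₑ-trans (⊑ₑ-meet (≐⇒⊑ (rem-ex y n₀ e Γ)) le) (exₑ-⊓ e (rem y n₀ Γ) Δ₀)
substitution-lemma (sub {M} {Θ₀} {V₀} D (p , q)) {y} {n} {W} {A} {Δ} h DA d
  with ⊑M-just (subst (λ t → ⊑M t (Θ₀ y n)) h (q y n))
... | W₀ , h₀ , r = sub IH (p , ⊑ₑ-meet (rem-⊑ y n q) ⊑ₑ-refl)
  where
  IH : substN y n A M ∶⟨ rem y n Θ₀ ⊓ₑ Δ ⊢₂ V₀ ⟩
  IH = substitution-lemma D h₀ (weaken-type DA r) (⋄-mono (rem-⊆ y n (⊆-⊑' q)) ⊆-refl d)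

contraction : ∀ {n B A Γ₁ Γ₂ U T} → lam n B ∶⟨ Γ₁ ⊢₂ ⌜ U ⇒ T ⌝ ⟩ → A ∶⟨ Γ₂ ⊢₂ U ⟩ → Γ₁ ⋄ₑ Γ₂ →
  instantiate B A ∶⟨ Γ₁ ⊓ₑ Γ₂ ⊢₂ ⌜ T ⌝ ⟩
contraction {n} {B} {A} {Γ₁} {Γ₂} D₁ D₂ d with generation-λ D₁ refl (here refl)
... | x , P , U' , T' , Γ' , refl , DP , e , i , U⊑U' , T'⊑T , Γ₁⊑Γ' =
  weaken-env (weaken-type D-subst T'⊑T) (⊑ₑ-meet (⊑ₑ-≐ Γ₁⊑Γ' (≐-sym Γ'-restored)) ⊑ₑ-refl)
  where
  Γ'-restored : rem x n (Γ' ,[ x , n ]∶ U') ≐ Γ'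
  Γ'-restored = rem-ext-inverse Γ' x n U' e
  D-subst : instantiate (close x n P) A ∶⟨ rem x n (Γ' ,[ x , n ]∶ U') ⊓ₑ Γ₂ ⊢₂ ⌜ T' ⌝ ⟩
  D-subst rewrite inst-close x n A P (Term-LC (term (typing-facts DP))) =
    substitution-lemma DP (ext-at Γ' x n U') (weaken-type D₂ U⊑U')
      (⋄-mono (λ w m h → ⊆-⊑' Γ₁⊑Γ' w m (trans (sym (Γ'-restored w m)) h)) ⊆-refl d)

-- Subject reduction for one step, by induction on the typing derivation.
-- Under a binder the step may use a different bound name x'; it is renamed
-- to the name x of the derivation.
mutual
  subject-reduction-step : ∀ {M Γ U N} → M ∶⟨ Γ ⊢₂ U ⟩ → M ▷β N → N ∶⟨ Γ ⊢₂ U ⟩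
  subject-reduction-step (ax g) ()
  subject-reduction-step (→I D e i) s = subject-reduction-λ D e i s refl
  subject-reduction-step (→E D₁ D₂ d j) (β t de) = contraction D₁ D₂ d
  subject-reduction-step (→E D₁ D₂ d j) (ξ-appˡ s t j1 j2) = →E (subject-reduction-step D₁ s) D₂ d j2
  subject-reduction-step (→E D₁ D₂ d j) (ξ-appʳ s t j1 j2) =
    →E D₁ (subject-reduction-step D₂ s) d (λ x m n a b → sym (j2 x n m b a))
  subject-reduction-step (∩I D₁ D₂) s = ∩I (subject-reduction-step D₁ s) (subject-reduction-step D₂ s)
  subject-reduction-step (exp {M} D) s with ⁺-reflects-▷β s M refl
  ... | N₀ , refl , s' = exp (subject-reduction-step D s')
  subject-reduction-step (sub D p) s = sub (subject-reduction-step D s) p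

  subject-reduction-λ : ∀ {M₀ Γ x n U T P N} → M₀ ∶⟨ Γ ,[ x , n ]∶ U ⊢₂ ⌜ T ⌝ ⟩ → Γ x n ≡ nothing →
    (x , n) ∈FV M₀ → P ▷β N → P ≡ lam n (close x n M₀) → N ∶⟨ Γ ⊢₂ ⌜ U ⇒ T ⌝ ⟩
  subject-reduction-λ {M₀} {Γ} {x} {n} {U} {T} D e i (ξ-lam {M'} {N'} {x'} s' i' j') eq with cong lamN eq
  ... | refl = subst (λ t → t ∶⟨ Γ ⊢₂ ⌜ U ⇒ T ⌝ ⟩) (cong (lam n) rebind)
                     (→I (subject-reduction-step D step) e (subst (λ t → (t , n) ∈FV swap x x' N') (swapℕ-right x x') (FV-swap x x' N' j')))
    where
    same-body : close x' n M' ≡ close x n M₀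
    same-body = cong lamB eq
    tM₀ : Term M₀
    tM₀ = term (typing-facts D)
    tM' : Term M'
    tM' = ▷β-Term s'
    x∉C : NoName x (close x n M₀)
    x∉C = NoName-λ (λ-binder-fresh tM₀ i)
    M'≡ : M' ≡ swap x x' M₀
    M'≡ = close-α x x' n M₀ M' (Term-LC tM₀) (Term-LC tM') (sym same-body) x∉C
            (subst (NoName x') same-body (NoName-λ (λ-binder-fresh tM' i')))
    step : M₀ ▷β swap x x' N'
    step = subst (_▷β swap x x' N') (swap-invol x x' M₀) (▷β-swap x x' (subst (_▷β N') M'≡ s'))
    x∉N : NoName x (close x' n N')
    x∉N k h = let a , b = FV-close⇒ 0 x' n N' h in
      x∉C k (subst (λ t → (x , k) ∈FV t) same-body (FV-close⇐ 0 x' n M' (FV-▷β⁻¹ s' a) b))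
    rebind : close x n (swap x x' N') ≡ close x' n N'
    rebind = close-rebind x x' n N' x∉N (▷β-binder-fresh s' tM' i')
  subject-reduction-λ D e i (β _ _) ()
  subject-reduction-λ D e i (ξ-appˡ _ _ _ _) ()
  subject-reduction-λ D e i (ξ-appʳ _ _ _ _) ()

subject-reduction : ∀ {M N Γ U} → M ∶⟨ Γ ⊢₂ U ⟩ → M ▷β* N → N ∶⟨ Γ ⊢₂ U ⟩
subject-reduction D ε        = D
subject-reduction D (s ◅ ss) = subject-reduction (subject-reduction-step D s) ss

variable-typing : ∀ y n V → GoodU V → degU V ≡ n → fv y n ∶⟨ ∅ ,[ y , n ]∶ V ⊢₂ V ⟩
variable-typing y n ⌜ T ⌝ (good-⌜⌝ g) d with trans (sym d) (degT≡0 T)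
... | refl = ax g
variable-typing y n (ex e V) (good-ex g) refl = retype-≐ (exp (variable-typing y (degU V) V g refl)) ex-decl
  where
  ex-decl : exₑ e (∅ ,[ y , degU V ]∶ V) ≐ (∅ ,[ y , suc (degU V) ]∶ ex e V)
  ex-decl w zero = sym (ext-other ∅ y (suc (degU V)) (ex e V) w 0 (λ q → 0≢1+n (proj₂ q)))
  ex-decl w (suc m) with sameVar w m y (degU V)
  ... | true  = refl
  ... | false = refl
variable-typing y n (V₁ ∩ V₂) (good-∩ g₁ g₂ e) d =
  retype-≐ (∩I (variable-typing y n V₁ g₁ d₁) (variable-typing y n V₂ g₂ (trans (sym e) d₁))) ∩-decl
  where
  d₁ : degU V₁ ≡ n
  d₁ = trans (sym (⊓-idem (degU V₁))) (trans (cong (degU V₁ ⊓_) e) d)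
  ∩-decl : ((∅ ,[ y , n ]∶ V₁) ⊓ₑ (∅ ,[ y , n ]∶ V₂)) ≐ (∅ ,[ y , n ]∶ (V₁ ∩ V₂))
  ∩-decl w m with sameVar w m y n
  ... | true  = refl
  ... | false = refl

AntiSubst : Env → UU → ℕ → ℕ → Tm → Tm → Set
AntiSubst Γ V y n A P = Σ UU λ W → Σ Env λ Θ → Σ Env λ Δ →
  P ∶⟨ Θ ⊢₂ V ⟩ × Θ y n ≡ just W × A ∶⟨ Δ ⊢₂ W ⟩ × Γ ⊑ₑ (rem y n Θ ⊓ₑ Δ)

-- The variable case: y^n gets the whole type V.
anti-substitution-var : ∀ {S Γ V y n A} → S ∶⟨ Γ ⊢₂ V ⟩ → S ≡ substN y n A (fv y n) → deg A ≡ n →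
  AntiSubst Γ V y n A (fv y n)
anti-substitution-var {S} {Γ} {V} {y} {n} {A} D eq dA rewrite sameVar-refl y n with eq
... | refl = V , ∅ ,[ y , n ]∶ V , Γ , variable-typing y n V good (trans deg-V dA) , ext-at ∅ y n V , D ,
             λ w m → subst (⊑M (Γ w m)) (cong (λ t → meetM t (Γ w m)) (sym (rem-ext-inverse ∅ y n V refl w m))) (⊑M-refl (Γ w m))
  where
  good : GoodU V
  good = proj₁ (type-good (typing-facts D))
  deg-V : degU V ≡ deg S
  deg-V = proj₂ (type-good (typing-facts D))

AntiSubst-∩ : ∀ {Γ₁ Γ₂ V₁ V₂ y n A P} → AntiSubst Γ₁ V₁ y n A P → AntiSubst Γ₂ V₂ y n A P →
  AntiSubst (Γ₁ ⊓ₑ Γ₂) (V₁ ∩ V₂) y n A P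
AntiSubst-∩ {y = y} {n} (W₁ , Θ₁ , Δ₁ , DP₁ , h₁ , DA₁ , le₁) (W₂ , Θ₂ , Δ₂ , DP₂ , h₂ , DA₂ , le₂) =
  W₁ ∩ W₂ , Θ₁ ⊓ₑ Θ₂ , Δ₁ ⊓ₑ Δ₂ , ∩I DP₁ DP₂ , cong₂ meetM h₁ h₂ , ∩I DA₁ DA₂ ,
  ⊑ₑ-trans (⊑ₑ-meet le₁ le₂) (≈ₑ⇒⊑ₑ (rem-meet-interchange y n Θ₁ Θ₂ Δ₁ Δ₂))

AntiSubst-app : ∀ {Γ₁ Γ₂ U T y n A P₁ P₂} → Joinable P₁ P₂ →
  AntiSubst Γ₁ ⌜ U ⇒ T ⌝ y n A P₁ → AntiSubst Γ₂ U y n A P₂ → AntiSubst (Γ₁ ⊓ₑ Γ₂) ⌜ T ⌝ y n A (app P₁ P₂)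
AntiSubst-app {y = y} {n} jP (W₁ , Θ₁ , Δ₁ , DP₁ , h₁ , DA₁ , le₁) (W₂ , Θ₂ , Δ₂ , DP₂ , h₂ , DA₂ , le₂) =
  W₁ ∩ W₂ , Θ₁ ⊓ₑ Θ₂ , Δ₁ ⊓ₑ Δ₂ , →E DP₁ DP₂ (Joinable⇒⋄ DP₁ DP₂ jP) jP , cong₂ meetM h₁ h₂ , ∩I DA₁ DA₂ ,
  ⊑ₑ-trans (⊑ₑ-meet le₁ le₂) (≈ₑ⇒⊑ₑ (rem-meet-interchange y n Θ₁ Θ₂ Δ₁ Δ₂))

AntiSubst-appˡ : ∀ {Γ₁ Γ₂ U T y n A P₁ P₂} → Joinable P₁ P₂ → P₂ ∶⟨ Γ₂ ⊢₂ U ⟩ → Γ₂ y n ≡ nothing →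
  AntiSubst Γ₁ ⌜ U ⇒ T ⌝ y n A P₁ → AntiSubst (Γ₁ ⊓ₑ Γ₂) ⌜ T ⌝ y n A (app P₁ P₂)
AntiSubst-appˡ {Γ₂ = Γ₂} {y = y} {n} jP D₂ e (W₁ , Θ₁ , Δ₁ , DP₁ , h₁ , DA₁ , le₁) =
  W₁ , Θ₁ ⊓ₑ Γ₂ , Δ₁ , →E DP₁ D₂ (Joinable⇒⋄ DP₁ D₂ jP) jP , cong₂ meetM h₁ e , DA₁ ,
  ⊑ₑ-trans (⊑ₑ-meet le₁ ⊑ₑ-refl) (≈ₑ⇒⊑ₑ (rem-meet-left y n Θ₁ Γ₂ Δ₁ e))

AntiSubst-appʳ : ∀ {Γ₁ Γ₂ U T y n A P₁ P₂} → Joinable P₁ P₂ → P₁ ∶⟨ Γ₁ ⊢₂ ⌜ U ⇒ T ⌝ ⟩ → Γ₁ y n ≡ nothing →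
  AntiSubst Γ₂ U y n A P₂ → AntiSubst (Γ₁ ⊓ₑ Γ₂) ⌜ T ⌝ y n A (app P₁ P₂)
AntiSubst-appʳ {Γ₁ = Γ₁} {y = y} {n} jP D₁ e (W₂ , Θ₂ , Δ₂ , DP₂ , h₂ , DA₂ , le₂) =
  W₂ , Γ₁ ⊓ₑ Θ₂ , Δ₂ , →E D₁ DP₂ (Joinable⇒⋄ D₁ DP₂ jP) jP , cong₂ meetM e h₂ , DA₂ ,
  ⊑ₑ-trans (⊑ₑ-meet ⊑ₑ-refl le₂) (≈ₑ⇒⊑ₑ (rem-meet-right y n Γ₁ Θ₂ Δ₂ e))

AntiSubst-ex : ∀ {Γ V y n A P} e → AntiSubst Γ V y n A P → AntiSubst (exₑ e Γ) (ex e V) y (suc n) (A ⁺) (P ⁺)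
AntiSubst-ex {y = y} {n} e (W , Θ , Δ , DP , h , DA , le) =
  ex e W , exₑ e Θ , exₑ e Δ , exp DP , cong (Maybe.map (ex e)) h , exp DA ,
  ⊑ₑ-trans (⊑ₑ-ex e le) (⊑ₑ-trans (exₑ-⊓' e (rem y n Θ) Δ) (⊑ₑ-meet (≐⇒⊑ (≐-sym (rem-ex y n e Θ))) ⊑ₑ-refl))

extract-binder : ∀ {Γ Θ Δ v m U y n} → ¬ y ≡ v → Γ v m ≡ nothing → Δ v m ≡ nothing →
  (Γ ,[ v , m ]∶ U) ⊑ₑ (rem y n Θ ⊓ₑ Δ) →
  Σ UU λ U'' → Θ v m ≡ just U'' × U ⊑ U'' × Γ ⊑ₑ (rem y n (rem v m Θ) ⊓ₑ Δ)
extract-binder {Γ} {Θ} {Δ} {v} {m} {U} {y} {n} y≢v Γv Δv le =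
  let U'' , Θv , U⊑ = ⊑M-meet-nothing (Θ v m)
        (subst₂ ⊑M (ext-at Γ v m U) (cong₂ meetM (rem-other y n Θ v m (λ q → y≢v (sym (proj₁ q)))) Δv) (le v m))
  in U'' , Θv , U⊑ , below
  where
  below : Γ ⊑ₑ (rem y n (rem v m Θ) ⊓ₑ Δ)
  below w k with var? w k v m
  ... | yes (refl , refl) =
    subst₂ ⊑M (sym Γv) (sym (cong₂ meetM (rem-nothing y n (rem v m Θ) v m (rem-at v m Θ)) Δv)) nothing
  ... | no ne = subst₂ ⊑M (ext-other Γ v m U w k ne)
                  (cong (λ t → meetM t (Δ w k)) (sym (rem-rem y n v m Θ w k ne))) (le w k)

anti-substitution-λ : ∀ {Γ z v m U T y n A P} → (∀ k → Γ z k ≡ nothing) → (∀ k → Γ v k ≡ nothing) →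
  NoName v A → ¬ y ≡ v → (v , m) ∈FV P →
  AntiSubst (Γ ,[ z , m ]∶ U) ⌜ T ⌝ (swapℕ z v y) n (swap z v A) (swap z v P) →
  AntiSubst Γ ⌜ U ⇒ T ⌝ y n A (lam m (close v m P))
anti-substitution-λ {Γ} {z} {v} {m} {U} {T} {y} {n} {A} {P} Γz Γv v∉A y≢v v∈P (W , Θ₁ , Δ₁ , DP₁ , h₁ , DA₁ , le₁) =
  W , rem v m Θ , Δ , weaken-type DL (⊑-⇒ U⊑U'' (⊑-refl ≈U-refl)) ,
  trans (rem-other v m Θ y n (λ q → y≢v (proj₁ q))) h₁ , DA , Γ-below
  where
  Θ Δ : Env
  Θ = swapₑ z v Θ₁
  Δ = swapₑ z v Δ₁
  DP : P ∶⟨ Θ ⊢₂ ⌜ T ⌝ ⟩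
  DP = subst (λ t → t ∶⟨ Θ ⊢₂ ⌜ T ⌝ ⟩) (swap-invol z v P) (rename-typing z v DP₁)
  DA : A ∶⟨ Δ ⊢₂ W ⟩
  DA = subst (λ t → t ∶⟨ Δ ⊢₂ W ⟩) (swap-invol z v A) (rename-typing z v DA₁)
  Γ-renamed : swapₑ z v (Γ ,[ z , m ]∶ U) ≐ (Γ ,[ v , m ]∶ U)
  Γ-renamed w k = trans (swapₑ-ext z v Γ z m U w k)
                (trans (cong (λ t → (swapₑ z v Γ ,[ t , m ]∶ U) w k) (swapℕ-left z v))
                       (ext-cong v m U (swapₑ-fresh z v Γ Γz Γv) w k))
  env-renamed : swapₑ z v (rem (swapℕ z v y) n Θ₁ ⊓ₑ Δ₁) ≐ (rem y n Θ ⊓ₑ Δ)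
  env-renamed w k = cong (λ t → meetM t (Δ w k))
    (trans (swapₑ-rem z v (swapℕ z v y) n Θ₁ w k) (cong (λ t → rem t n Θ w k) (swapℕ-invol z v y)))
  below-ext : (Γ ,[ v , m ]∶ U) ⊑ₑ (rem y n Θ ⊓ₑ Δ)
  below-ext = ≐-⊑ₑ Γ-renamed (⊑ₑ-≐ (λ w k → le₁ (swapℕ z v w) k) env-renamed)
  extracted : Σ UU λ U'' → Θ v m ≡ just U'' × U ⊑ U'' × Γ ⊑ₑ (rem y n (rem v m Θ) ⊓ₑ Δ)
  extracted = extract-binder y≢v (Γv m) (fresh-outside-dom DA v∉A m) below-ext
  U'' : UU
  U'' = proj₁ extracted
  U⊑U'' : U ⊑ U''
  U⊑U'' = proj₁ (proj₂ (proj₂ extracted))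
  Γ-below : Γ ⊑ₑ (rem y n (rem v m Θ) ⊓ₑ Δ)
  Γ-below = proj₂ (proj₂ (proj₂ extracted))
  DL : lam m (close v m P) ∶⟨ rem v m Θ ⊢₂ ⌜ U'' ⇒ T ⌝ ⟩
  DL = →I (retype-≐ DP (rem-ext-split Θ v m (proj₁ (proj₂ extracted)))) (rem-at v m Θ) v∈P

anti-substitution : ∀ {S Γ V} → S ∶⟨ Γ ⊢₂ V ⟩ → ∀ {y n A P} → S ≡ substN y n A P → Term P → (y , n) ∈FV P →
  Term A → deg A ≡ n → AntiSubst Γ V y n A P
anti-substitution D {P = fv _ _} eq tP fv-here tA dA = anti-substitution-var D eq dA
anti-substitution D {P = bv _ _} eq tP () tA dA
anti-substitution (ax g)       {P = lam _ _} () tP i tA dA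
anti-substitution (ax g)       {P = app _ _} () tP i tA dA
anti-substitution (→I _ _ _)   {P = app _ _} () tP i tA dA
anti-substitution (→E _ _ _ _) {P = lam _ _} () tP i tA dA
anti-substitution (→I {Q} {Γ} {z} {m} {U} {T} D e z∈Q) {y} {n} {A} {lam m' _} eq (term-lam {P₀} {w} tP₀ w∈P₀) (fv-lam y∈C) tA dA
  with cong lamN eq
... | refl = subst (AntiSubst Γ ⌜ U ⇒ T ⌝ y n A) (cong (lam m) rebind)
      (anti-substitution-λ Γz Γv v∉A y≢v v∈P
         (anti-substitution D Q≡ (Term-swap z v tP) (FV-swap z v P y∈P) (Term-swap z v tA) (trans (swap-deg z v A) dA)))
  where
  -- v is fresh for Q, A and P₀; P is P₀ with its bound name w renamed to v.
  v : ℕ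
  v = suc (maxFV Q ⊔ maxFV A ⊔ maxFV P₀)
  v∉Q : NoName v Q
  v∉Q = fresh-NoName Q (s≤s (≤-trans (m≤m⊔n (maxFV Q) (maxFV A)) (m≤m⊔n _ _)))
  v∉A : NoName v A
  v∉A = fresh-NoName A (s≤s (≤-trans (m≤n⊔m (maxFV Q) (maxFV A)) (m≤m⊔n _ _)))
  v∉P₀ : NoName v P₀
  v∉P₀ = fresh-NoName P₀ (s≤s (m≤n⊔m _ _))
  y∈P₀ : (y , n) ∈FV P₀ × ¬ (y ≡ w × n ≡ m)
  y∈P₀ = FV-close⇒ 0 w m P₀ y∈C
  y≢w : ¬ y ≡ w
  y≢w refl = proj₂ y∈P₀ (refl , Term-self-joinable tP₀ y n m (proj₁ y∈P₀) w∈P₀)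
  y≢v : ¬ y ≡ v
  y≢v refl = v∉P₀ n (proj₁ y∈P₀)
  P : Tm
  P = swap v w P₀
  tP : Term P
  tP = Term-swap v w tP₀
  y∈P : (y , n) ∈FV P
  y∈P = subst (λ t → (t , n) ∈FV P) (swapℕ-other v w y y≢v y≢w) (FV-swap v w P₀ (proj₁ y∈P₀))
  v∈P : (v , m) ∈FV P
  v∈P = subst (λ t → (t , m) ∈FV P) (swapℕ-right v w) (FV-swap v w P₀ w∈P₀)
  rebind : close v m P ≡ close w m P₀
  rebind = close-rebind v w m P₀ (λ k h → v∉P₀ k (proj₁ (FV-close⇒ 0 w m P₀ h))) (NoName-λ (λ-binder-fresh tP₀ w∈P₀))
  z∉C : NoName z (close z m Q)
  z∉C = NoName-λ (λ-binder-fresh (term (typing-facts D)) z∈Q)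
  v∉C : NoName v (close z m Q)
  v∉C k h = v∉Q k (proj₁ (FV-close⇒ 0 z m Q h))
  Γz : ∀ k → Γ z k ≡ nothing
  Γz = fresh-outside-dom (→I D e z∈Q) (λ { k (fv-lam h) → z∉C k h })
  Γv : ∀ k → Γ v k ≡ nothing
  Γv = fresh-outside-dom (→I D e z∈Q) (λ { k (fv-lam h) → v∉C k h })
  -- The body of the substituted abstraction, closed over v, is the body Q
  -- closed over z, so the two differ by the swap of z and v.
  same-body : close z m Q ≡ close v m (substN y n A P)
  same-body = trans (cong lamB eq)
    (trans (cong (substN y n A) (sym rebind)) (subst-close 0 y n A v m P y≢v (v∉A m)))
  Q≡ : Q ≡ substN (swapℕ z v y) n (swap z v A) (swap z v P)
  Q≡ = begin
    Q                           ≡⟨ sym (swap-invol z v Q) ⟩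
    swap z v (swap z v Q)       ≡⟨ cong (swap z v) (sym (close-α z v m Q (substN y n A P) (Term-LC (term (typing-facts D)))
                                     (substN-LC 0 y n A P (Term-LC tP) (Term-LC tA)) same-body z∉C v∉C)) ⟩
    swap z v (substN y n A P)   ≡⟨ swap-subst z v y n A P ⟩
    substN (swapℕ z v y) n (swap z v A) (swap z v P) ∎
    where open ≡-Reasoning
anti-substitution (→E {S₁} {S₂} {Γ₁} {Γ₂} {U} {T} D₁ D₂ d j) {y} {n} {A} {app P₁ P₂} eq (term-app t₁ t₂ jP) i tA dA
  with FV-dec y n P₁ | FV-dec y n P₂
... | yes k₁ | yes k₂ =
  AntiSubst-app jP (anti-substitution D₁ (cong appL eq) t₁ k₁ tA dA) (anti-substitution D₂ (cong appR eq) t₂ k₂ tA dA)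
... | yes k₁ | no k₂ =
  AntiSubst-appˡ jP D₂' (outside-dom D₂' k₂) (anti-substitution D₁ (cong appL eq) t₁ k₁ tA dA)
  where
  D₂' : P₂ ∶⟨ Γ₂ ⊢₂ U ⟩
  D₂' = subst (λ t → t ∶⟨ Γ₂ ⊢₂ U ⟩) (trans (cong appR eq) (subst-notin y n A P₂ k₂)) D₂
... | no k₁ | yes k₂ =
  AntiSubst-appʳ jP D₁' (outside-dom D₁' k₁) (anti-substitution D₂ (cong appR eq) t₂ k₂ tA dA)
  where
  D₁' : P₁ ∶⟨ Γ₁ ⊢₂ ⌜ U ⇒ T ⌝ ⟩
  D₁' = subst (λ t → t ∶⟨ Γ₁ ⊢₂ ⌜ U ⇒ T ⌝ ⟩) (trans (cong appL eq) (subst-notin y n A P₁ k₁)) D₁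
... | no k₁ | no k₂ with i
...   | fv-appˡ h = ⊥-elim (k₁ h)
...   | fv-appʳ h = ⊥-elim (k₂ h)
anti-substitution (∩I D₁ D₂) eq tP i tA dA =
  AntiSubst-∩ (anti-substitution D₁ eq tP i tA dA) (anti-substitution D₂ eq tP i tA dA)
anti-substitution (sub D (p , q)) eq tP i tA dA with anti-substitution D eq tP i tA dA
... | W , Θ , Δ , DP , h , DA , le = W , Θ , Δ , weaken-type DP p , h , DA , ⊑ₑ-trans q le
-- Under an expansion the substituted term is a shift, hence so are P and A,
-- and n > 0 since A has the degree of a shifted term.
anti-substitution (exp {S₀} D) {y} {zero} {A} {P} eq tP i tA dA
  with subst (1 ≤_) dA (Pos-deg A (Pos-subst⇒A y zero A P i (subst Pos eq (Pos-⁺ S₀))))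
... | ()
anti-substitution (exp {S₀} {e = e} D) {y} {suc n₀} {A} {P} eq tP i tA dA
  with unshift P (Pos-subst⇒P y (suc n₀) A P (s≤s z≤n) (subst Pos eq (Pos-⁺ S₀)))
     | unshift A (Pos-subst⇒A y (suc n₀) A P i (subst Pos eq (Pos-⁺ S₀)))
... | P₀ , refl | A₀ , refl =
  AntiSubst-ex e (anti-substitution D (⁺-inj S₀ (substN y n₀ A₀ P₀) (trans eq (sym (subst⁺ y n₀ A₀ P₀))))
    (Term⁻ tP P₀ refl) (FV-⁺⇐' P₀ i) (Term⁻ tA A₀ refl) (suc-injective (trans (sym (deg⁺ A₀)) dA)))

expansion-β : ∀ {n B A Γ T} → instantiate B A ∶⟨ Γ ⊢₂ ⌜ T ⌝ ⟩ → Term (app (lam n B) A) → deg A ≡ n →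
  app (lam n B) A ∶⟨ Γ ⊢₂ ⌜ T ⌝ ⟩
expansion-β {n} {_} {A} {Γ} {T} D (term-app (term-lam {B₀} {x} {n} tB i) tA j) dA
  with anti-substitution D (inst-close x n A B₀ (Term-LC tB)) tB i tA dA
... | W , Θ , Δ , DP , h , DA , le = weaken-env (→E DL DA (Joinable⇒⋄ DL DA j) j) le
  where
  DL : lam n (close x n B₀) ∶⟨ rem x n Θ ⊢₂ ⌜ W ⇒ T ⌝ ⟩
  DL = →I (retype-≐ DP (rem-ext-split Θ x n h)) (rem-at x n Θ) i

-- For the axiom, →I and →E the step is either a
-- root β-step (handled by expansion-β) or lies inside; the auxiliary
-- functions carry the equation identifying the reduct with the typed term.
mutual
  subject-expansion-step : ∀ {N Γ U M} → N ∶⟨ Γ ⊢₂ U ⟩ → M ▷β N → M ∶⟨ Γ ⊢₂ U ⟩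
  subject-expansion-step D@(ax g)        s = subject-expansion-var D s refl
  subject-expansion-step D@(→I D' e i)   s = subject-expansion-λ D D' e i s refl
  subject-expansion-step D@(→E D₁ D₂ d j) s = subject-expansion-app D D₁ D₂ d s refl
  subject-expansion-step (∩I D₁ D₂) s = ∩I (subject-expansion-step D₁ s) (subject-expansion-step D₂ s)
  subject-expansion-step (exp {N₀} D) s with ▷β-⁺-target N₀ s
  ... | M₀ , refl , s' = exp (subject-expansion-step D s')
  subject-expansion-step (sub D p) s = sub (subject-expansion-step D s) p

  subject-expansion-var : ∀ {x Γ T M N'} → fv x 0 ∶⟨ Γ ⊢₂ ⌜ T ⌝ ⟩ → M ▷β N' → N' ≡ fv x 0 → M ∶⟨ Γ ⊢₂ ⌜ T ⌝ ⟩
  subject-expansion-var D (β t e) eq = expansion-β (subst (λ t → t ∶⟨ _ ⊢₂ _ ⟩) (sym eq) D) t e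
  subject-expansion-var D (ξ-lam s i j) ()
  subject-expansion-var D (ξ-appˡ s t j1 j2) ()
  subject-expansion-var D (ξ-appʳ s t j1 j2) ()

  subject-expansion-λ : ∀ {N₀ Γ x n U T M N'} → lam n (close x n N₀) ∶⟨ Γ ⊢₂ ⌜ U ⇒ T ⌝ ⟩ →
    N₀ ∶⟨ Γ ,[ x , n ]∶ U ⊢₂ ⌜ T ⌝ ⟩ → Γ x n ≡ nothing → (x , n) ∈FV N₀ →
    M ▷β N' → N' ≡ lam n (close x n N₀) → M ∶⟨ Γ ⊢₂ ⌜ U ⇒ T ⌝ ⟩
  subject-expansion-λ D D' e i (β t de) eq = expansion-β (subst (λ t → t ∶⟨ _ ⊢₂ _ ⟩) (sym eq) D) t de
  subject-expansion-λ D D' e i (ξ-appˡ _ _ _ _) ()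
  subject-expansion-λ D D' e i (ξ-appʳ _ _ _ _) ()
  subject-expansion-λ {N₀} {Γ} {x} {n} {U} {T} D D' e i (ξ-lam {M'} {N'} {x'} s' i' j') eq with cong lamN eq
  ... | refl = subst (λ t → t ∶⟨ Γ ⊢₂ ⌜ U ⇒ T ⌝ ⟩) (cong (lam n) rebind)
                     (→I (subject-expansion-step D' step) e (subst (λ t → (t , n) ∈FV swap x x' M') (swapℕ-right x x') (FV-swap x x' M' i')))
    where
    same-body : close x' n N' ≡ close x n N₀
    same-body = cong lamB eq
    tN₀ : Term N₀
    tN₀ = term (typing-facts D')
    tM' : Term M'
    tM' = ▷β-Term s'
    x∉C : NoName x (close x n N₀)
    x∉C = NoName-λ (λ-binder-fresh tN₀ i)
    N'≡ : N' ≡ swap x x' N₀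
    N'≡ = close-α x x' n N₀ N' (Term-LC tN₀) (▷β-LC s') (sym same-body) x∉C
            (subst (NoName x') same-body (▷β-binder-fresh s' tM' i'))
    step : swap x x' M' ▷β N₀
    step = subst (swap x x' M' ▷β_) (trans (cong (swap x x') N'≡) (swap-invol x x' N₀)) (▷β-swap x x' s')
    x∉M : NoName x (close x' n M')
    x∉M k h = let a , b = FV-close⇒ 0 x' n M' h in
      x∉C k (subst (λ t → (x , k) ∈FV t) same-body (FV-close⇐ 0 x' n N' (FV-▷β s' a) b))
    rebind : close x n (swap x x' M') ≡ close x' n M'
    rebind = close-rebind x x' n M' x∉M (NoName-λ (λ-binder-fresh tM' i'))

  subject-expansion-app : ∀ {N₁ N₂ Γ₁ Γ₂ U T M N'} → app N₁ N₂ ∶⟨ Γ₁ ⊓ₑ Γ₂ ⊢₂ ⌜ T ⌝ ⟩ →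
    N₁ ∶⟨ Γ₁ ⊢₂ ⌜ U ⇒ T ⌝ ⟩ → N₂ ∶⟨ Γ₂ ⊢₂ U ⟩ → Γ₁ ⋄ₑ Γ₂ →
    M ▷β N' → N' ≡ app N₁ N₂ → M ∶⟨ Γ₁ ⊓ₑ Γ₂ ⊢₂ ⌜ T ⌝ ⟩
  subject-expansion-app D D₁ D₂ d (β t de) eq = expansion-β (subst (λ t → t ∶⟨ _ ⊢₂ _ ⟩) (sym eq) D) t de
  subject-expansion-app D D₁ D₂ d (ξ-lam _ _ _) ()
  subject-expansion-app D D₁ D₂ d (ξ-appˡ s t j1 j2) refl = →E (subject-expansion-step D₁ s) D₂ d j1
  subject-expansion-app D D₁ D₂ d (ξ-appʳ s t j1 j2) refl =
    →E D₁ (subject-expansion-step D₂ s) d (λ x m n a b → sym (j1 x n m b a))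

subject-expansion : ∀ {M N Γ U} → N ∶⟨ Γ ⊢₂ U ⟩ → M ▷β* N → M ∶⟨ Γ ⊢₂ U ⟩
subject-expansion D ε        = D
subject-expansion D (s ◅ ss) = subject-expansion-step (subject-expansion D ss) s

lemma1 : (M N : Tm) (Γ : Env) (U : UU) → Term M → Term N → FinEnv Γ →
    (M ∶⟨ Γ ⊢₂ U ⟩ → M ▷β* N → N ∶⟨ Γ ⊢₂ U ⟩) ×
    (N ∶⟨ Γ ⊢₂ U ⟩ → M ▷β* N → M ∶⟨ Γ ⊢₂ U ⟩)
lemma1 M N Γ U _ _ _ = subject-reduction , subject-expansion
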